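{- Let $\nu\ge1$ and $n\ge0$ be integers. (1) If $n$ is odd or $\nu$ is even, then \[ (-1)^{\nu-1}\sum_{\tau=0}^{\nu-1}(-1)^\tau\big(p(n-\tau(2\tau+1))-p(n-(\tau+1)(2\tau+1))\big)\le p(n-\nu(2\nu+1)). \] (2) If $n$ is odd, then \[ (-1)^{\nu-1}\sum_{\tau=0}^{\nu-1}(-1)^\tau\big(p_o(n-\tau(2\tau+1))-p_o(n-(\tau+1)(2\tau+1))\big)\le p_o(n-\nu(2\nu+1)). \] In both cases the inequality is strict if $n>\nu(2\nu+3)$.
   Context: $p(n)$ is the number of partitions of $n$ and $p_o(n)$ the number of partitions of $n$ into odd parts; $p(x)=p_o(x)=0$ for $x<0$. -}

module Defs where

open import Data.Nat as ℕ using (ℕ; zero; suc; _∸_; _/_)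
open import Data.Integer as ℤ using (ℤ; +_; -[1+_]; _-_; -_)
open import Data.List using (List; map; upTo)
open import Data.List as L using ()
open import Data.Nat.ListAction using (sum)
open import Data.Bool using (if_then_else_)

-- pParts k n = number of partitions of n (in ℕ) into parts from {1,…,k}
-- (standard recursion on the largest allowed part k: choose its multiplicity j)
pParts : ℕ → ℕ → ℕ
pParts zero    n = if n ℕ.≡ᵇ 0 then 1 else 0
pParts (suc k) n = sum (map (λ j → pParts k (n ∸ j ℕ.* suc k)) (upTo (suc (n / suc k))))

-- oParts k n = number of partitions of n into odd parts from {1,3,…,2k-1}
oParts : ℕ → ℕ → ℕ
oParts zero    n = if n ℕ.≡ᵇ 0 then 1 else 0
oParts (suc k) n =
  sum (map (λ j → oParts k (n ∸ j ℕ.* (suc (2 ℕ.* k)))) (upTo (suc (n / (suc (2 ℕ.* k))))))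

pℕ : ℕ → ℕ
pℕ n = pParts n n

-- p_o n : partitions of n into odd parts (odd parts ≤ 2n-1 covers all parts ≤ n)
poℕ : ℕ → ℕ
poℕ n = oParts n n

p : ℤ → ℤ
p (+ n)    = + pℕ n
p -[1+ _ ] = + 0

pₒ : ℤ → ℤ
pₒ (+ n)    = + poℕ n
pₒ -[1+ _ ] = + 0

sgn : ℕ → ℤ
sgn zero    = + 1
sgn (suc k) = - sgn k

altSum : (ℤ → ℤ) → ℕ → ℕ → ℤ
altSum f ν n = L.foldr ℤ._+_ (+ 0) (map term (upTo ν))
  where
  term : ℕ → ℤ
  term τ = sgn τ ℤ.* (f (+ n - + (τ ℕ.* (2 ℕ.* τ ℕ.+ 1)))
                      - f (+ n - + (suc τ ℕ.* (2 ℕ.* τ ℕ.+ 1))))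

-- The full sum Σ_{τ ∈ ℤ} (-1)^τ f(n - τ(2τ+1)) is the n-th coefficient of Gauss's series
-- Σ_τ (-1)^τ q^(τ(2τ+1)) = (q;q)_∞ / (q²;q⁴)_∞ times the generating function of f. For f = p this
-- product is 1/(q²;q⁴)_∞, whose coefficients are nonnegative and vanish in odd degrees; for f = pₒ
-- it is (q⁴;q⁴)_∞, which vanishes in odd degrees. The right-hand side minus the left-hand side of
-- the inequality is (-1)^ν times the full sum plus the alternating tail h_ν - h_(ν+1) + ⋯ of the
-- nonincreasing nonnegative sequence h_k = f(n - (k+1)(2k+1)) + f(n - (k+1)(2k+3)); such a tail is
-- nonnegative, and positive when h_(ν+1) < h_ν, which holds for n > ν(2ν+3) since f(m) < f(m+3).
-- Gauss's identity is proved over formal power series from the q-binomial theorem: the product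
-- ∏_{i<2N} (q^(4N-1) - q^(4i)) times ∏_{j<2N} 1/(1 - q^(2j+1)) is ± a monomial, and in low degrees
-- the q-binomial coefficients in q⁴ of its expansion agree with 1/(q⁴;q⁴)_∞.

{-# OPTIONS --safe #-}
module Submission where

open import Algebra.Structures using (IsCommutativeSemiring)
open import Algebra.Structures.Biased using (IsCommutativeSemiringˡ)
import Algebra.Solver.Ring
import Algebra.Solver.Ring.AlmostCommutativeRing as ACR
open import Data.Bool using (Bool; true; false; not; if_then_else_)
open import Data.Bool.Properties using (not-involutive)
open import Data.Integer as ℤ using (ℤ; +_; -[1+_]; _-_; _≤_; _<_)
import Data.Integer.Properties as ℤP
open import Data.Integer.Tactic.RingSolver using () renaming (solve-∀ to ℤ-solve-∀)
open import Data.List using (foldr; map; applyUpTo; upTo)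
open import Data.List.Properties using (map-upTo; map-∘; map-cong)
open import Data.Maybe using (Maybe; just; nothing)
open import Data.Nat as ℕ using (ℕ; zero; suc; z≤n; s≤s)
open import Data.Nat.DivMod using (_%_; _/_)
import Data.Nat.DivMod as ℕDM
open import Data.Nat.Induction using (<-rec)
open import Data.Nat.ListAction using (sum)
import Data.Nat.Properties as ℕP
open import Data.Nat.Tactic.RingSolver using () renaming (solve-∀ to ℕ-solve-∀)
open import Data.Product using (Σ; _,_; _×_; proj₁; proj₂)
open import Data.Sum using (_⊎_; inj₁; inj₂)
open import Function using (_∘_)
open import Level using (0ℓ)
open import Relation.Binary.PropositionalEquality
open import Relation.Binary.Structures using (IsEquivalence)
open import Relation.Nullary using (yes; no)
open import Algebra.Properties.CommutativeSemigroup ℤP.+-commutativeSemigroup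
  using () renaming (interchange to ℤ+-interchange)

open import Defs

-- Formal power series over ℤ

Series : Set
Series = ℕ → ℤ

infix 4 _≈_
record _≈_ (f g : Series) : Set where
  constructor mk≈
  field at : ∀ n → f n ≡ g n
open _≈_ public

≈-refl : ∀ {f} → f ≈ f
≈-refl = mk≈ λ _ → refl

≈-sym : ∀ {f g} → f ≈ g → g ≈ f
≈-sym (mk≈ p) = mk≈ λ n → sym (p n)

≈-trans : ∀ {f g h} → f ≈ g → g ≈ h → f ≈ h
≈-trans (mk≈ p) (mk≈ q) = mk≈ λ n → trans (p n) (q n)

≈-reflexive : ∀ {f g} → f ≡ g → f ≈ g
≈-reflexive refl = ≈-refl

tail : Series → Series
tail f n = f (suc n)

𝟘 𝟙 : Series
𝟘 _ = + 0
𝟙 zero    = + 1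
𝟙 (suc _) = + 0

infixl 6 _⊕_
infixl 7 _⊛_

_⊕_ : Series → Series → Series
(f ⊕ g) n = f n ℤ.+ g n

⊖_ : Series → Series
(⊖ f) n = ℤ.- f n

_⊛_ : Series → Series → Series
(f ⊛ g) zero    = f 0 ℤ.* g 0
(f ⊛ g) (suc n) = f 0 ℤ.* g (suc n) ℤ.+ (tail f ⊛ g) n

scale : ℤ → Series → Series
scale c f n = c ℤ.* f n

⊛-cong-at : ∀ {f f' g g'} → (∀ n → f n ≡ f' n) → (∀ n → g n ≡ g' n) →
            ∀ n → (f ⊛ g) n ≡ (f' ⊛ g') n
⊛-cong-at p q zero    = cong₂ ℤ._*_ (p 0) (q 0)
⊛-cong-at p q (suc n) = cong₂ ℤ._+_ (cong₂ ℤ._*_ (p 0) (q (suc n))) (⊛-cong-at (p ∘ suc) q n)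

⊛-cong : ∀ {f f' g g'} → f ≈ f' → g ≈ g' → f ⊛ g ≈ f' ⊛ g'
⊛-cong (mk≈ p) (mk≈ q) = mk≈ (⊛-cong-at p q)

⊛-distribʳ-⊕-at : ∀ f g h n → ((f ⊕ g) ⊛ h) n ≡ (f ⊛ h ⊕ g ⊛ h) n
⊛-distribʳ-⊕-at f g h zero    = ℤP.*-distribʳ-+ (h 0) (f 0) (g 0)
⊛-distribʳ-⊕-at f g h (suc n) = begin
  (f 0 ℤ.+ g 0) ℤ.* h (suc n) ℤ.+ ((tail f ⊕ tail g) ⊛ h) n
    ≡⟨ cong₂ ℤ._+_ (ℤP.*-distribʳ-+ (h (suc n)) (f 0) (g 0)) (⊛-distribʳ-⊕-at (tail f) (tail g) h n) ⟩
  (f 0 ℤ.* h (suc n) ℤ.+ g 0 ℤ.* h (suc n)) ℤ.+ ((tail f ⊛ h) n ℤ.+ (tail g ⊛ h) n)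
    ≡⟨ ℤ+-interchange (f 0 ℤ.* h (suc n)) (g 0 ℤ.* h (suc n)) ((tail f ⊛ h) n) ((tail g ⊛ h) n) ⟩
  (f 0 ℤ.* h (suc n) ℤ.+ (tail f ⊛ h) n) ℤ.+ (g 0 ℤ.* h (suc n) ℤ.+ (tail g ⊛ h) n) ∎
  where open ≡-Reasoning

scale-⊛-at : ∀ c f g n → (scale c f ⊛ g) n ≡ c ℤ.* (f ⊛ g) n
scale-⊛-at c f g zero    = ℤP.*-assoc c (f 0) (g 0)
scale-⊛-at c f g (suc n) = begin
  c ℤ.* f 0 ℤ.* g (suc n) ℤ.+ (scale c (tail f) ⊛ g) n
    ≡⟨ cong (ℤ._+_ (c ℤ.* f 0 ℤ.* g (suc n))) (scale-⊛-at c (tail f) g n) ⟩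
  c ℤ.* f 0 ℤ.* g (suc n) ℤ.+ c ℤ.* (tail f ⊛ g) n
    ≡⟨ lemma c (f 0) (g (suc n)) ((tail f ⊛ g) n) ⟩
  c ℤ.* (f 0 ℤ.* g (suc n) ℤ.+ (tail f ⊛ g) n) ∎
  where
  open ≡-Reasoning
  lemma : ∀ a b c d → a ℤ.* b ℤ.* c ℤ.+ a ℤ.* d ≡ a ℤ.* (b ℤ.* c ℤ.+ d)
  lemma = ℤ-solve-∀

⊛-zeroˡ-at : ∀ g n → (𝟘 ⊛ g) n ≡ + 0
⊛-zeroˡ-at g zero    = refl
⊛-zeroˡ-at g (suc n) = cong (ℤ._+_ (+ 0 ℤ.* g (suc n))) (⊛-zeroˡ-at g n)

⊛-identityˡ-at : ∀ g n → (𝟙 ⊛ g) n ≡ g n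
⊛-identityˡ-at g zero    = ℤP.*-identityˡ (g 0)
⊛-identityˡ-at g (suc n) = begin
  + 1 ℤ.* g (suc n) ℤ.+ (tail 𝟙 ⊛ g) n
    ≡⟨ cong₂ ℤ._+_ (ℤP.*-identityˡ (g (suc n))) (⊛-zeroˡ-at g n) ⟩
  g (suc n) ℤ.+ + 0
    ≡⟨ ℤP.+-identityʳ _ ⟩
  g (suc n) ∎
  where open ≡-Reasoning

-- The second step is unfolded twice so that both recursive calls are on tails.
⊛-comm-at : ∀ f g n → (f ⊛ g) n ≡ (g ⊛ f) n
⊛-comm-at f g zero          = ℤP.*-comm (f 0) (g 0)
⊛-comm-at f g (suc zero)    = lemma (f 0) (g 1) (f 1) (g 0)
  where
  lemma : ∀ a b c d → a ℤ.* b ℤ.+ c ℤ.* d ≡ d ℤ.* c ℤ.+ b ℤ.* a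
  lemma = ℤ-solve-∀
⊛-comm-at f g (suc (suc m)) = begin
  f 0 ℤ.* g (2 ℕ.+ m) ℤ.+ (tail f ⊛ g) (suc m)
    ≡⟨ cong (ℤ._+_ (f 0 ℤ.* g (2 ℕ.+ m))) (⊛-comm-at (tail f) g (suc m)) ⟩
  f 0 ℤ.* g (2 ℕ.+ m) ℤ.+ (g 0 ℤ.* f (2 ℕ.+ m) ℤ.+ (tail g ⊛ tail f) m)
    ≡⟨ cong (λ x → f 0 ℤ.* g (2 ℕ.+ m) ℤ.+ (g 0 ℤ.* f (2 ℕ.+ m) ℤ.+ x)) (⊛-comm-at (tail g) (tail f) m) ⟩
  f 0 ℤ.* g (2 ℕ.+ m) ℤ.+ (g 0 ℤ.* f (2 ℕ.+ m) ℤ.+ (tail f ⊛ tail g) m)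
    ≡⟨ lemma (f 0) (g (2 ℕ.+ m)) (g 0) (f (2 ℕ.+ m)) ((tail f ⊛ tail g) m) ⟩
  g 0 ℤ.* f (2 ℕ.+ m) ℤ.+ (f 0 ℤ.* g (2 ℕ.+ m) ℤ.+ (tail f ⊛ tail g) m)
    ≡⟨ cong (ℤ._+_ (g 0 ℤ.* f (2 ℕ.+ m))) (sym (⊛-comm-at (tail g) f (suc m))) ⟩
  g 0 ℤ.* f (2 ℕ.+ m) ℤ.+ (tail g ⊛ f) (suc m) ∎
  where
  open ≡-Reasoning
  lemma : ∀ a b c d e → a ℤ.* b ℤ.+ (c ℤ.* d ℤ.+ e) ≡ c ℤ.* d ℤ.+ (a ℤ.* b ℤ.+ e)
  lemma = ℤ-solve-∀

⊛-assoc-at : ∀ f g h n → ((f ⊛ g) ⊛ h) n ≡ (f ⊛ (g ⊛ h)) n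
⊛-assoc-at f g h zero    = ℤP.*-assoc (f 0) (g 0) (h 0)
⊛-assoc-at f g h (suc n) = begin
  f 0 ℤ.* g 0 ℤ.* h (suc n) ℤ.+ ((scale (f 0) (tail g) ⊕ (tail f ⊛ g)) ⊛ h) n
    ≡⟨ cong (ℤ._+_ (f 0 ℤ.* g 0 ℤ.* h (suc n))) (⊛-distribʳ-⊕-at (scale (f 0) (tail g)) (tail f ⊛ g) h n) ⟩
  f 0 ℤ.* g 0 ℤ.* h (suc n) ℤ.+ ((scale (f 0) (tail g) ⊛ h) n ℤ.+ ((tail f ⊛ g) ⊛ h) n)
    ≡⟨ cong₂ (λ x y → f 0 ℤ.* g 0 ℤ.* h (suc n) ℤ.+ (x ℤ.+ y))
             (scale-⊛-at (f 0) (tail g) h n) (⊛-assoc-at (tail f) g h n) ⟩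
  f 0 ℤ.* g 0 ℤ.* h (suc n) ℤ.+ (f 0 ℤ.* (tail g ⊛ h) n ℤ.+ (tail f ⊛ (g ⊛ h)) n)
    ≡⟨ lemma (f 0) (g 0) (h (suc n)) ((tail g ⊛ h) n) ((tail f ⊛ (g ⊛ h)) n) ⟩
  f 0 ℤ.* (g 0 ℤ.* h (suc n) ℤ.+ (tail g ⊛ h) n) ℤ.+ (tail f ⊛ (g ⊛ h)) n ∎
  where
  open ≡-Reasoning
  lemma : ∀ a b c d e → a ℤ.* b ℤ.* c ℤ.+ (a ℤ.* d ℤ.+ e) ≡ a ℤ.* (b ℤ.* c ℤ.+ d) ℤ.+ e
  lemma = ℤ-solve-∀

neg-⊛-at : ∀ f g n → ((⊖ f) ⊛ g) n ≡ ℤ.- (f ⊛ g) n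
neg-⊛-at f g n =
  trans (⊛-cong-at (λ m → sym (ℤP.-1*i≡-i (f m))) (λ _ → refl) n)
        (trans (scale-⊛-at (ℤ.- + 1) f g n) (ℤP.-1*i≡-i _))

⊕-⊛-isCommutativeSemiring : IsCommutativeSemiring _≈_ _⊕_ _⊛_ 𝟘 𝟙
⊕-⊛-isCommutativeSemiring = IsCommutativeSemiringˡ.isCommutativeSemiring record
  { +-isCommutativeMonoid = record
    { isMonoid = record
      { isSemigroup = record
        { isMagma = record
          { isEquivalence = ≈-isEquivalence
          ; ∙-cong = λ (mk≈ p) (mk≈ q) → mk≈ λ n → cong₂ ℤ._+_ (p n) (q n) }
        ; assoc = λ f g h → mk≈ λ n → ℤP.+-assoc (f n) (g n) (h n) }
      ; identity = (λ f → mk≈ λ n → ℤP.+-identityˡ (f n)) , (λ f → mk≈ λ n → ℤP.+-identityʳ (f n)) }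
    ; comm = λ f g → mk≈ λ n → ℤP.+-comm (f n) (g n) }
  ; *-isCommutativeMonoid = record
    { isMonoid = record
      { isSemigroup = record
        { isMagma = record { isEquivalence = ≈-isEquivalence ; ∙-cong = ⊛-cong }
        ; assoc = λ f g h → mk≈ (⊛-assoc-at f g h) }
      ; identity = (λ g → mk≈ (⊛-identityˡ-at g))
                 , (λ g → mk≈ λ n → trans (⊛-comm-at g 𝟙 n) (⊛-identityˡ-at g n)) }
    ; comm = λ f g → mk≈ (⊛-comm-at f g) }
  ; distribʳ = λ h f g → mk≈ (⊛-distribʳ-⊕-at f g h)
  ; zeroˡ = λ g → mk≈ (⊛-zeroˡ-at g)
  }
  where
  ≈-isEquivalence : IsEquivalence _≈_
  ≈-isEquivalence = record { refl = ≈-refl ; sym = ≈-sym ; trans = ≈-trans }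

seriesRing : ACR.AlmostCommutativeRing 0ℓ 0ℓ
seriesRing = record
  { Carrier = Series ; _≈_ = _≈_ ; _+_ = _⊕_ ; _*_ = _⊛_ ; -_ = ⊖_ ; 0# = 𝟘 ; 1# = 𝟙
  ; isAlmostCommutativeRing = record
    { isCommutativeSemiring = ⊕-⊛-isCommutativeSemiring
    ; -‿cong = λ (mk≈ p) → mk≈ λ n → cong ℤ.-_ (p n)
    ; -‿*-distribˡ = λ f g → mk≈ (neg-⊛-at f g)
    ; -‿+-comm = λ f g → mk≈ λ n → sym (ℤP.neg-distrib-+ (f n) (g n)) } }

module R = ACR.AlmostCommutativeRing seriesRing

constant : ℤ → Series
constant c = scale c 𝟙

constant-homomorphism : ACR._-Raw-AlmostCommutative⟶_ ℤ.+-*-rawRing seriesRing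
constant-homomorphism = record
  { ⟦_⟧    = constant
  ; +-homo = λ a b → mk≈ λ n → ℤP.*-distribʳ-+ (𝟙 n) a b
  ; *-homo = λ a b → mk≈ λ n → trans (ℤP.*-assoc a b (𝟙 n))
               (trans (cong (a ℤ.*_) (sym (⊛-identityˡ-at (constant b) n))) (sym (scale-⊛-at a 𝟙 (constant b) n)))
  ; -‿homo = λ a → mk≈ λ n → sym (ℤP.neg-distribˡ-* a (𝟙 n))
  ; 0-homo = mk≈ λ n → ℤP.*-zeroˡ (𝟙 n)
  ; 1-homo = mk≈ λ n → ℤP.*-identityˡ (𝟙 n) }

constant-≟ : ∀ a b → Maybe (constant a ≈ constant b)
constant-≟ a b with a ℤ.≟ b
... | yes refl = just ≈-refl
... | no _     = nothing

open Algebra.Solver.Ring ℤ.+-*-rawRing seriesRing constant-homomorphism constant-≟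
  using (solve; _:=_; _:+_; _:*_; :-_; _:-_)

⊕-congˡ : ∀ a {b c} → b ≈ c → a ⊕ b ≈ a ⊕ c
⊕-congˡ a p = R.+-cong (≈-refl {a}) p

⊕-congʳ : ∀ {b c} a → b ≈ c → b ⊕ a ≈ c ⊕ a
⊕-congʳ a p = R.+-cong p (≈-refl {a})

⊛-congˡ : ∀ a {b c} → b ≈ c → a ⊛ b ≈ a ⊛ c
⊛-congˡ a p = ⊛-cong (≈-refl {a}) p

⊛-congʳ : ∀ {b c} a → b ≈ c → b ⊛ a ≈ c ⊛ a
⊛-congʳ a p = ⊛-cong p (≈-refl {a})

below-or-offset : ∀ a n → n ℕ.< a ⊎ Σ ℕ (λ m → a ℕ.+ m ≡ n)
below-or-offset a n with n ℕ.<? a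
... | yes n<a = inj₁ n<a
... | no  n≮a = inj₂ (ℕP.m≤n⇒∃[o]m+o≡n (ℕP.≮⇒≥ n≮a))

shift₁ : Series → Series
shift₁ f zero    = + 0
shift₁ f (suc n) = f n

shift : ℕ → Series → Series
shift zero    f = f
shift (suc a) f = shift₁ (shift a f)

X^ : ℕ → Series
X^ a = shift a 𝟙

shift₁-cong : ∀ {f g} → f ≈ g → shift₁ f ≈ shift₁ g
shift₁-cong (mk≈ p) = mk≈ λ { zero → refl ; (suc n) → p n }

shift-cong : ∀ a {f g} → f ≈ g → shift a f ≈ shift a g
shift-cong zero    p = p
shift-cong (suc a) p = shift₁-cong (shift-cong a p)

shift₁-⊛-at : ∀ f g n → (shift₁ f ⊛ g) n ≡ shift₁ (f ⊛ g) n
shift₁-⊛-at f g zero    = ℤP.*-zeroˡ (g 0)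
shift₁-⊛-at f g (suc n) =
  trans (cong (ℤ._+ (f ⊛ g) n) (ℤP.*-zeroˡ (g (suc n)))) (ℤP.+-identityˡ _)

shift-⊛ : ∀ a f g → shift a f ⊛ g ≈ shift a (f ⊛ g)
shift-⊛ zero    f g = ≈-refl
shift-⊛ (suc a) f g = ≈-trans (mk≈ (shift₁-⊛-at (shift a f) g)) (shift₁-cong (shift-⊛ a f g))

shift≈X^⊛ : ∀ a f → shift a f ≈ X^ a ⊛ f
shift≈X^⊛ a f = ≈-sym (≈-trans (shift-⊛ a 𝟙 f) (shift-cong a (mk≈ (⊛-identityˡ-at f))))

shift-shift : ∀ a b f → shift a (shift b f) ≈ shift (a ℕ.+ b) f
shift-shift zero    b f = ≈-refl
shift-shift (suc a) b f = shift₁-cong (shift-shift a b f)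

X^-+ : ∀ a b → X^ a ⊛ X^ b ≈ X^ (a ℕ.+ b)
X^-+ a b = ≈-sym (≈-trans (≈-sym (shift-shift a b 𝟙)) (shift≈X^⊛ a (X^ b)))

X^-cong : ∀ {a b} → a ≡ b → X^ a ≈ X^ b
X^-cong refl = ≈-refl

X^-split : ∀ a b → a ℕ.≤ b → X^ b ≈ X^ a ⊛ X^ (b ℕ.∸ a)
X^-split a b a≤b = ≈-trans (X^-cong (sym (ℕP.m+[n∸m]≡n a≤b))) (≈-sym (X^-+ a (b ℕ.∸ a)))

shift-at : ∀ a f m → shift a f (a ℕ.+ m) ≡ f m
shift-at zero    f m = refl
shift-at (suc a) f m = shift-at a f m

shift-below : ∀ a f m → m ℕ.< a → shift a f m ≡ + 0
shift-below (suc a) f zero    _           = refl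
shift-below (suc a) f (suc m) (s≤s m<a) = shift-below a f m m<a

shift-injective : ∀ a {f g} → shift a f ≈ shift a g → f ≈ g
shift-injective a (mk≈ p) = mk≈ λ m → trans (sym (shift-at a _ m)) (trans (p (a ℕ.+ m)) (shift-at a _ m))

infix 4 _≈[_]_
_≈[_]_ : Series → ℕ → Series → Set
f ≈[ K ] g = ∀ n → n ℕ.< K → f n ≡ g n

≈⇒≈[] : ∀ {f g} K → f ≈ g → f ≈[ K ] g
≈⇒≈[] K (mk≈ p) n _ = p n

≈[]-sym : ∀ {f g K} → f ≈[ K ] g → g ≈[ K ] f
≈[]-sym p n n<K = sym (p n n<K)

≈[]-trans : ∀ {f g h K} → f ≈[ K ] g → g ≈[ K ] h → f ≈[ K ] h
≈[]-trans p q n n<K = trans (p n n<K) (q n n<K)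

≈[]-weaken : ∀ {f g K L} → L ℕ.≤ K → f ≈[ K ] g → f ≈[ L ] g
≈[]-weaken L≤K p n n<L = p n (ℕP.<-≤-trans n<L L≤K)

≈[]-⊕ : ∀ {f f' g g' K} → f ≈[ K ] f' → g ≈[ K ] g' → f ⊕ g ≈[ K ] f' ⊕ g'
≈[]-⊕ p q n n<K = cong₂ ℤ._+_ (p n n<K) (q n n<K)

≈[]-⊛ʳ : ∀ {f f' K} g → f ≈[ K ] f' → f ⊛ g ≈[ K ] f' ⊛ g
≈[]-⊛ʳ g p zero    n<K = cong (ℤ._* g 0) (p 0 n<K)
≈[]-⊛ʳ {f} {f'} {suc K} g p (suc n) (s≤s n<K) =
  cong₂ ℤ._+_ (cong (ℤ._* g (suc n)) (p 0 (s≤s z≤n)))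
              (≈[]-⊛ʳ {tail f} {tail f'} {K} g (λ m m<K → p (suc m) (s≤s m<K)) n n<K)

≈[]-⊛ˡ : ∀ {g g' K} f → g ≈[ K ] g' → f ⊛ g ≈[ K ] f ⊛ g'
≈[]-⊛ˡ {g} {g'} f p n n<K = trans (⊛-comm-at f g n) (trans (≈[]-⊛ʳ f p n n<K) (⊛-comm-at g' f n))

≈[]-X^⊛ : ∀ a {f g K} → f ≈[ K ] g → X^ a ⊛ f ≈[ a ℕ.+ K ] X^ a ⊛ g
≈[]-X^⊛ a {f} {g} p n n< =
  trans (sym (at (shift≈X^⊛ a f) n)) (trans (shifted a p n n<) (at (shift≈X^⊛ a g) n))
  where
  shifted : ∀ a {f g K} → f ≈[ K ] g → shift a f ≈[ a ℕ.+ K ] shift a g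
  shifted zero    p = p
  shifted (suc a) p zero    _        = refl
  shifted (suc a) p (suc n) (s≤s n<) = shifted a p n n<

X^⊛≈[]𝟘 : ∀ a f → X^ a ⊛ f ≈[ a ] 𝟘
X^⊛≈[]𝟘 a f n n< = trans (sym (at (shift≈X^⊛ a f) n)) (shift-below a f n n<)

NonNeg : Series → Set
NonNeg f = ∀ n → + 0 ℤ.≤ f n

NonNeg-𝟙 : NonNeg 𝟙
NonNeg-𝟙 zero    = ℤ.+≤+ z≤n
NonNeg-𝟙 (suc n) = ℤ.+≤+ z≤n

0≤-* : ∀ {a b} → + 0 ℤ.≤ a → + 0 ℤ.≤ b → + 0 ℤ.≤ a ℤ.* b
0≤-* {+ m} {+ k} _ _ = subst (+ 0 ℤ.≤_) (ℤP.pos-* m k) (ℤ.+≤+ z≤n)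

NonNeg-⊛ : ∀ {f g} → NonNeg f → NonNeg g → NonNeg (f ⊛ g)
NonNeg-⊛ p q zero    = 0≤-* (p 0) (q 0)
NonNeg-⊛ {f} {g} p q (suc n) =
  ℤP.+-mono-≤ (0≤-* (p 0) (q (suc n))) (NonNeg-⊛ {tail f} {g} (p ∘ suc) q n)

⊛-lowerBound : ∀ f g → NonNeg f → NonNeg g → ∀ n → f n ℤ.* g 0 ℤ.≤ (f ⊛ g) n
⊛-lowerBound f g p q zero    = ℤP.≤-refl
⊛-lowerBound f g p q (suc n) =
  ℤP.≤-trans (⊛-lowerBound (tail f) g (p ∘ suc) q n)
             (ℤP.i≤j⇒i≤k+j (f 0 ℤ.* g (suc n)) {{nonNeg (0≤-* (p 0) (q (suc n)))}} ℤP.≤-refl)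
  where
  nonNeg : ∀ {x} → + 0 ℤ.≤ x → ℤ.NonNegative x
  nonNeg (ℤ.+≤+ _) = _

isEven : ℕ → Bool
isEven zero    = true
isEven (suc n) = not (isEven n)

isEven-+ : ∀ a b → isEven (a ℕ.+ b) ≡ (if isEven a then isEven b else not (isEven b))
isEven-+ zero    b = refl
isEven-+ (suc a) b with isEven a | isEven-+ a b
... | true  | e = cong not e
... | false | e = trans (cong not e) (not-involutive (isEven b))

isEven-+-even : ∀ a b → isEven a ≡ true → isEven (a ℕ.+ b) ≡ isEven b
isEven-+-even a b ea = trans (isEven-+ a b) (cong (λ e → if e then isEven b else not (isEven b)) ea)

EvenSupported OddSupported : Series → Set
EvenSupported f = ∀ n → isEven n ≡ false → f n ≡ + 0
OddSupported  f = ∀ n → isEven n ≡ true  → f n ≡ + 0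

EvenSupported-⊛ : ∀ {f g} → EvenSupported f → EvenSupported g → EvenSupported (f ⊛ g)
OddSupported-⊛  : ∀ {f g} → OddSupported f → EvenSupported g → OddSupported (f ⊛ g)
EvenSupported-⊛ p q zero ()
EvenSupported-⊛ {f} {g} p q (suc n) e =
  cong₂ ℤ._+_ (trans (cong (f 0 ℤ.*_) (q (suc n) e)) (ℤP.*-zeroʳ (f 0)))
              (OddSupported-⊛ {tail f} {g} (λ m em → p (suc m) (cong not em)) q n (not-false e))
  where
  not-false : ∀ {b} → not b ≡ false → b ≡ true
  not-false {true} _ = refl
OddSupported-⊛ p q zero e = cong (ℤ._* _) (p 0 refl)
OddSupported-⊛ {f} {g} p q (suc n) e =
  cong₂ ℤ._+_ (cong (ℤ._* g (suc n)) (p 0 refl))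
              (EvenSupported-⊛ {tail f} {g} (λ m em → p (suc m) (cong not em)) q n (not-true e))
  where
  not-true : ∀ {b} → not b ≡ true → b ≡ false
  not-true {false} _ = refl

EvenSupported-𝟙 : EvenSupported 𝟙
EvenSupported-𝟙 zero ()
EvenSupported-𝟙 (suc n) _ = refl

EvenSupported-⊕ : ∀ {f g} → EvenSupported f → EvenSupported g → EvenSupported (f ⊕ g)
EvenSupported-⊕ p q n e = cong₂ ℤ._+_ (p n e) (q n e)

EvenSupported-⊖ : ∀ {f} → EvenSupported f → EvenSupported (⊖ f)
EvenSupported-⊖ p n e = cong ℤ.-_ (p n e)

EvenSupported-shift : ∀ a {f} → isEven a ≡ true → EvenSupported f → EvenSupported (shift a f)
EvenSupported-shift a {f} ea p n en with below-or-offset a n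
... | inj₁ n<a        = shift-below a f n n<a
... | inj₂ (m , refl) = trans (shift-at a f m) (p m (trans (sym (isEven-+-even a m ea)) en))

1-X^ : ℕ → Series
1-X^ a = 𝟙 ⊕ ⊖ X^ a

-- The power series 1/(1 - X^a); the case a = 0 is a junk value.
Geom : ℕ → Series
Geom zero    = 𝟙
Geom (suc c) n = if n % suc c ℕ.≡ᵇ 0 then + 1 else + 0

Geom-unfold-at : ∀ c n → Geom (suc c) n ≡ (𝟙 ⊕ shift (suc c) (Geom (suc c))) n
Geom-unfold-at c n with below-or-offset (suc c) n
... | inj₁ n<a rewrite ℕDM.m<n⇒m%n≡m n<a | shift-below (suc c) (Geom (suc c)) n n<a = indicator n
  where
  indicator : ∀ n → (if n ℕ.≡ᵇ 0 then + 1 else + 0) ≡ 𝟙 n ℤ.+ + 0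
  indicator zero    = refl
  indicator (suc n) = refl
... | inj₂ (m , refl) =
  trans (cong (λ r → if r ℕ.≡ᵇ 0 then + 1 else + 0)
              (trans (cong (_% suc c) (ℕP.+-comm (suc c) m)) (ℕDM.[m+n]%n≡m%n m (suc c))))
        (sym (trans (ℤP.+-identityˡ _) (shift-at (suc c) (Geom (suc c)) m)))

Geom-unfold : ∀ c → Geom (suc c) ≈ 𝟙 ⊕ shift (suc c) (Geom (suc c))
Geom-unfold c = mk≈ (Geom-unfold-at c)

NonNeg-Geom : ∀ a → NonNeg (Geom a)
NonNeg-Geom zero    = NonNeg-𝟙
NonNeg-Geom (suc c) n with n % suc c ℕ.≡ᵇ 0
... | true  = ℤ.+≤+ z≤n
... | false = ℤ.+≤+ z≤n

Geom-head : ∀ a → Geom a 0 ≡ + 1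
Geom-head zero    = refl
Geom-head (suc c) = refl

Geom1-at : ∀ n → Geom 1 n ≡ + 1
Geom1-at n rewrite ℕDM.n%1≡0 n = refl

Geom≈[]𝟙 : ∀ c → Geom (suc c) ≈[ suc c ] 𝟙
Geom≈[]𝟙 c n n<a =
  trans (Geom-unfold-at c n) (trans (cong (ℤ._+_ (𝟙 n)) (shift-below (suc c) _ n n<a)) (ℤP.+-identityʳ _))

EvenSupported-Geom : ∀ a → isEven a ≡ true → EvenSupported (Geom a)
EvenSupported-Geom zero    _  = EvenSupported-𝟙
EvenSupported-Geom (suc c) ea = <-rec _ step
  where
  step : ∀ n → (∀ {m} → m ℕ.< n → isEven m ≡ false → Geom (suc c) m ≡ + 0) →
         isEven n ≡ false → Geom (suc c) n ≡ + 0
  step n ih en with below-or-offset (suc c) n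
  ... | inj₁ n<a = trans (Geom-unfold-at c n) (cong₂ ℤ._+_ (EvenSupported-𝟙 n en) (shift-below (suc c) _ n n<a))
  ... | inj₂ (m , refl) =
    trans (Geom-unfold-at c (suc c ℕ.+ m))
          (cong₂ ℤ._+_ (EvenSupported-𝟙 (suc c ℕ.+ m) en)
                       (trans (shift-at (suc c) _ m)
                              (ih (ℕP.m<n+m m (s≤s z≤n)) (trans (sym (isEven-+-even (suc c) m ea)) en))))

1-X^⊛Geom : ∀ a → 1 ℕ.≤ a → 1-X^ a ⊛ Geom a ≈ 𝟙
1-X^⊛Geom (suc c) _ =
  ≈-trans (solve 3 (λ o x g → (o :- x) :* g := o :* g :- x :* g) ≈-refl 𝟙 (X^ (suc c)) (Geom (suc c)))
  (≈-trans (⊕-congʳ _ (R.*-identityˡ (Geom (suc c))))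
  (≈-trans (⊕-congʳ _ (≈-trans (Geom-unfold c) (⊕-congˡ 𝟙 (shift≈X^⊛ (suc c) (Geom (suc c))))))
           (solve 3 (λ o x g → (o :+ x :* g) :- x :* g := o) ≈-refl 𝟙 (X^ (suc c)) (Geom (suc c)))))

⊛Geom-unfold : ∀ F c → F ⊛ Geom (suc c) ≈ F ⊕ shift (suc c) (F ⊛ Geom (suc c))
⊛Geom-unfold F c =
  ≈-trans (⊛-congˡ F (Geom-unfold c))
  (≈-trans (R.distribˡ F 𝟙 (shift (suc c) (Geom (suc c))))
  (R.+-cong (R.*-identityʳ F)
    (≈-trans (R.*-comm F _)
    (≈-trans (shift-⊛ (suc c) (Geom (suc c)) F) (shift-cong (suc c) (R.*-comm (Geom (suc c)) F))))))

⊛Geom≈[] : ∀ {F F' K} a → 1 ℕ.≤ a → K ℕ.≤ a → F ≈[ K ] F' → F ⊛ Geom a ≈[ K ] F'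
⊛Geom≈[] {F} {K = K} (suc c) _ K≤a p =
  ≈[]-trans (≈[]-⊛ˡ F (≈[]-weaken K≤a (Geom≈[]𝟙 c)))
            (≈[]-trans (≈⇒≈[] K (R.*-identityʳ F)) p)

EvenSupported-1-X^ : ∀ a → isEven a ≡ true → EvenSupported (1-X^ a)
EvenSupported-1-X^ a ea = EvenSupported-⊕ EvenSupported-𝟙 (EvenSupported-⊖ (EvenSupported-shift a ea EvenSupported-𝟙))

Σₛ : ℕ → (ℕ → Series) → Series
Σₛ zero    g = 𝟘
Σₛ (suc k) g = g 0 ⊕ Σₛ k (g ∘ suc)

Σₛ-cong : ∀ k {g h} → (∀ i → i ℕ.< k → g i ≈ h i) → Σₛ k g ≈ Σₛ k h
Σₛ-cong zero e = ≈-refl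
Σₛ-cong (suc k) e = R.+-cong (e 0 (s≤s z≤n)) (Σₛ-cong k (λ i i<k → e (suc i) (s≤s i<k)))

Σₛ-last : ∀ k g → Σₛ (suc k) g ≈ Σₛ k g ⊕ g k
Σₛ-last zero g = ≈-trans (R.+-identityʳ (g 0)) (≈-sym (R.+-identityˡ (g 0)))
Σₛ-last (suc k) g = ≈-trans (⊕-congˡ (g 0) (Σₛ-last k (g ∘ suc))) (≈-sym (R.+-assoc (g 0) _ _))

⊛-Σₛ : ∀ k F g → F ⊛ Σₛ k g ≈ Σₛ k (λ i → F ⊛ g i)
⊛-Σₛ zero F g = R.zeroʳ F
⊛-Σₛ (suc k) F g = ≈-trans (R.distribˡ F (g 0) _) (⊕-congˡ (F ⊛ g 0) (⊛-Σₛ k F (g ∘ suc)))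

Σₛ-⊛ : ∀ k F g → Σₛ k g ⊛ F ≈ Σₛ k (λ i → g i ⊛ F)
Σₛ-⊛ k F g = ≈-trans (R.*-comm _ F) (≈-trans (⊛-Σₛ k F g) (Σₛ-cong k (λ i _ → R.*-comm F (g i))))

Σₛ-⊕ : ∀ k g h → Σₛ k (λ i → g i ⊕ h i) ≈ Σₛ k g ⊕ Σₛ k h
Σₛ-⊕ zero g h = ≈-sym (R.+-identityˡ 𝟘)
Σₛ-⊕ (suc k) g h = ≈-trans (⊕-congˡ (g 0 ⊕ h 0) (Σₛ-⊕ k (g ∘ suc) (h ∘ suc)))
  (solve 4 (λ a b c d → (a :+ b) :+ (c :+ d) := (a :+ c) :+ (b :+ d)) ≈-refl (g 0) (h 0) (Σₛ k (g ∘ suc)) (Σₛ k (h ∘ suc)))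

Σₛ-+ : ∀ a b g → Σₛ (a ℕ.+ b) g ≈ Σₛ a g ⊕ Σₛ b (λ i → g (a ℕ.+ i))
Σₛ-+ zero b g = ≈-sym (R.+-identityˡ _)
Σₛ-+ (suc a) b g = ≈-trans (⊕-congˡ (g 0) (Σₛ-+ a b (g ∘ suc))) (≈-sym (R.+-assoc (g 0) _ _))

Σₛ-reverse : ∀ k g → Σₛ k g ≈ Σₛ k (λ τ → g (k ℕ.∸ suc τ))
Σₛ-reverse zero g = ≈-refl
Σₛ-reverse (suc k) g = ≈-trans (⊕-congˡ (g 0) (Σₛ-reverse k (g ∘ suc)))
  (≈-trans (R.+-comm (g 0) _)
  (≈-trans (R.+-cong (Σₛ-cong k (λ τ τ<k → ≈-reflexive (cong g (sym (ℕP.+-∸-assoc 1 τ<k)))))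
                     (≈-reflexive (cong g (sym (ℕP.n∸n≡0 k)))))
   (≈-sym (Σₛ-last k (λ τ → g (suc k ℕ.∸ suc τ))))))

Σₛ-⊖ : ∀ k g → Σₛ k (λ i → ⊖ g i) ≈ ⊖ Σₛ k g
Σₛ-⊖ zero    g = mk≈ λ n → refl
Σₛ-⊖ (suc k) g = ≈-trans (⊕-congˡ (⊖ g 0) (Σₛ-⊖ k (g ∘ suc))) (R.-‿+-comm (g 0) _)

Σₛ-≈[] : ∀ k {g h K} → (∀ i → i ℕ.< k → g i ≈[ K ] h i) → Σₛ k g ≈[ K ] Σₛ k h
Σₛ-≈[] zero    e n _ = refl
Σₛ-≈[] (suc k) e     = ≈[]-⊕ (e 0 (s≤s z≤n)) (Σₛ-≈[] k (λ i i<k → e (suc i) (s≤s i<k)))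

Prod Prod↓ : ℕ → (ℕ → Series) → ℕ → ℕ → Series
Prod  d F c zero    = 𝟙
Prod  d F c (suc M) = F c ⊛ Prod d F (c ℕ.+ d) M
Prod↓ d F c zero    = 𝟙
Prod↓ d F c (suc M) = F c ⊛ Prod↓ d F (c ℕ.∸ d) M

Prod-start : ∀ d F {c c'} M → c ≡ c' → Prod d F c M ≈ Prod d F c' M
Prod-start d F M refl = ≈-refl

Prod-snoc : ∀ d F c M → Prod d F c (suc M) ≈ Prod d F c M ⊛ F (c ℕ.+ d ℕ.* M)
Prod-snoc d F c zero    =
  ≈-trans (R.*-comm (F c) 𝟙) (⊛-congˡ 𝟙 (≈-reflexive (cong F (sym (trans (cong (c ℕ.+_) (ℕP.*-zeroʳ d)) (ℕP.+-identityʳ c))))))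
Prod-snoc d F c (suc M) =
  ≈-trans (⊛-congˡ (F c) (Prod-snoc d F (c ℕ.+ d) M))
  (≈-trans (≈-sym (R.*-assoc (F c) _ _)) (⊛-congˡ (Prod d F c (suc M)) (≈-reflexive (cong F (offset c d M)))))
  where
  offset : ∀ c d M → c ℕ.+ d ℕ.+ d ℕ.* M ≡ c ℕ.+ d ℕ.* suc M
  offset = ℕ-solve-∀

Prod-interleave : ∀ d F c M → Prod d F c (2 ℕ.* M) ≈ Prod (2 ℕ.* d) F c M ⊛ Prod (2 ℕ.* d) F (c ℕ.+ d) M
Prod-interleave d F c zero    = ≈-sym (R.*-identityˡ 𝟙)
Prod-interleave d F c (suc M) =
  ≈-trans (≈-reflexive (cong (Prod d F c) (twice-suc M)))
  (≈-trans (⊛-congˡ (F c) (⊛-congˡ (F (c ℕ.+ d)) (Prod-interleave d F (c ℕ.+ d ℕ.+ d) M)))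
  (≈-trans (solve 4 (λ x y p q → x :* (y :* (p :* q)) := (x :* p) :* (y :* q)) ≈-refl
                    (F c) (F (c ℕ.+ d)) (Prod (2 ℕ.* d) F (c ℕ.+ d ℕ.+ d) M) (Prod (2 ℕ.* d) F (c ℕ.+ d ℕ.+ d ℕ.+ d) M))
           (⊛-cong (⊛-congˡ (F c) (Prod-start (2 ℕ.* d) F M (step c d)))
                   (⊛-congˡ (F (c ℕ.+ d)) (Prod-start (2 ℕ.* d) F M (step (c ℕ.+ d) d))))))
  where
  twice-suc : ∀ M → 2 ℕ.* suc M ≡ suc (suc (2 ℕ.* M))
  twice-suc = ℕ-solve-∀
  step : ∀ c d → c ℕ.+ d ℕ.+ d ≡ c ℕ.+ 2 ℕ.* d
  step = ℕ-solve-∀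

Prod↓≈Prod : ∀ F k → Prod↓ 4 F (4 ℕ.* k ℕ.+ 3) (suc k) ≈ Prod 4 F 3 (suc k)
Prod↓≈Prod F zero    = ≈-refl
Prod↓≈Prod F (suc k) =
  ≈-trans (⊛-congˡ (F c) (≈-trans (≈-reflexive (cong (λ c' → Prod↓ 4 F c' (suc k)) step)) (Prod↓≈Prod F k)))
  (≈-trans (R.*-comm (F c) _)
           (≈-trans (⊛-congˡ (Prod 4 F 3 (suc k)) (≈-reflexive (cong F (top k)))) (≈-sym (Prod-snoc 4 F 3 (suc k)))))
  where
  c = 4 ℕ.* suc k ℕ.+ 3
  shifted : ∀ k → 4 ℕ.* suc k ℕ.+ 3 ≡ 4 ℕ.+ (4 ℕ.* k ℕ.+ 3)
  shifted = ℕ-solve-∀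
  step : c ℕ.∸ 4 ≡ 4 ℕ.* k ℕ.+ 3
  step = trans (cong (ℕ._∸ 4) (shifted k)) (ℕP.m+n∸m≡n 4 (4 ℕ.* k ℕ.+ 3))
  top : ∀ k → 4 ℕ.* suc k ℕ.+ 3 ≡ 3 ℕ.+ 4 ℕ.* suc k
  top = ℕ-solve-∀

Prod-inverse : ∀ d F H → (∀ a → 1 ℕ.≤ a → F a ⊛ H a ≈ 𝟙) → ∀ c M → 1 ℕ.≤ c → Prod d F c M ⊛ Prod d H c M ≈ 𝟙
Prod-inverse d F H inv c zero    _   = R.*-identityˡ 𝟙
Prod-inverse d F H inv c (suc M) 1≤c =
  ≈-trans (solve 4 (λ f p h q → (f :* p) :* (h :* q) := (f :* h) :* (p :* q)) ≈-refl
                   (F c) (Prod d F (c ℕ.+ d) M) (H c) (Prod d H (c ℕ.+ d) M))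
  (≈-trans (⊛-cong (inv c 1≤c) (Prod-inverse d F H inv (c ℕ.+ d) M (ℕP.≤-trans 1≤c (ℕP.m≤m+n c d))))
           (R.*-identityˡ 𝟙))

NonNeg-Prod : ∀ d F → (∀ a → NonNeg (F a)) → ∀ c M → NonNeg (Prod d F c M)
NonNeg-Prod d F nonNeg c zero    = NonNeg-𝟙
NonNeg-Prod d F nonNeg c (suc M) = NonNeg-⊛ (nonNeg c) (NonNeg-Prod d F nonNeg (c ℕ.+ d) M)

Prod-head : ∀ d F → (∀ a → F a 0 ≡ + 1) → ∀ c M → Prod d F c M 0 ≡ + 1
Prod-head d F head c zero    = refl
Prod-head d F head c (suc M) = cong₂ ℤ._*_ (head c) (Prod-head d F head (c ℕ.+ d) M)

EvenSupported-Prod : ∀ d F → isEven d ≡ true → (∀ a → isEven a ≡ true → EvenSupported (F a)) →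
                     ∀ c M → isEven c ≡ true → EvenSupported (Prod d F c M)
EvenSupported-Prod d F ed even c zero    ec = EvenSupported-𝟙
EvenSupported-Prod d F ed even c (suc M) ec =
  EvenSupported-⊛ (even c ec) (EvenSupported-Prod d F ed even (c ℕ.+ d) M (trans (isEven-+-even c d ec) ed))

ProdGeom-stable : ∀ d c j e → 1 ℕ.≤ c → Prod d Geom c j ≈[ c ℕ.+ d ℕ.* j ] Prod d Geom c (e ℕ.+ j)
ProdGeom-stable d c j zero    _   = λ _ _ → refl
ProdGeom-stable d c j (suc e) 1≤c =
  ≈[]-trans (ProdGeom-stable d c j e 1≤c)
  (≈[]-trans (≈[]-sym (⊛Geom≈[] (c ℕ.+ d ℕ.* (e ℕ.+ j)) (ℕP.≤-trans 1≤c (ℕP.m≤m+n c _))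
                                (ℕP.+-monoʳ-≤ c (ℕP.*-monoʳ-≤ d (ℕP.m≤n+m j e))) (λ _ _ → refl)))
             (≈⇒≈[] _ (≈-sym (Prod-snoc d Geom c (e ℕ.+ j)))))

-- Partition generating functions

multiplicitySum : (ℕ → ℕ) → ℕ → ℕ → ℕ
multiplicitySum f c n = sum (map (λ j → f (n ℕ.∸ j ℕ.* suc c)) (upTo (suc (n / suc c))))

multiplicitySum-step : ∀ f c m →
  multiplicitySum f c (suc c ℕ.+ m) ≡ f (suc c ℕ.+ m) ℕ.+ multiplicitySum f c m
multiplicitySum-step f c m = begin
  sum (map g (upTo (suc ((suc c ℕ.+ m) / suc c))))
    ≡⟨ cong (λ t → sum (map g (upTo (suc t)))) quotient ⟩
  g 0 ℕ.+ sum (map g (applyUpTo suc (suc (m / suc c))))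
    ≡⟨ cong (λ xs → g 0 ℕ.+ sum xs) shifted ⟩
  f (suc c ℕ.+ m) ℕ.+ multiplicitySum f c m ∎
  where
  open ≡-Reasoning
  g g' : ℕ → ℕ
  g j  = f ((suc c ℕ.+ m) ℕ.∸ j ℕ.* suc c)
  g' j = f (m ℕ.∸ j ℕ.* suc c)
  quotient : (suc c ℕ.+ m) / suc c ≡ suc (m / suc c)
  quotient = trans (ℕDM.m/n≡1+[m∸n]/n (ℕP.m≤m+n (suc c) m)) (cong (λ t → suc (t / suc c)) (ℕP.m+n∸m≡n (suc c) m))
  shifted : map g (applyUpTo suc (suc (m / suc c))) ≡ map g' (upTo (suc (m / suc c)))
  shifted = trans (cong (map g) (sym (map-upTo suc _)))
                  (trans (sym (map-∘ (upTo _)))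
                         (map-cong (λ j → cong f (ℕP.[m+n]∸[m+o]≡n∸o (suc c) m (j ℕ.* suc c))) (upTo _)))

multiplicitySum≡⊛Geom : ∀ (f : ℕ → ℕ) (F : Series) → (∀ m → + f m ≡ F m) →
                        ∀ c n → + multiplicitySum f c n ≡ (F ⊛ Geom (suc c)) n
multiplicitySum≡⊛Geom f F f≡F c = <-rec _ step
  where
  step : ∀ n → (∀ {m} → m ℕ.< n → + multiplicitySum f c m ≡ (F ⊛ Geom (suc c)) m) →
         + multiplicitySum f c n ≡ (F ⊛ Geom (suc c)) n
  step n ih with below-or-offset (suc c) n
  ... | inj₁ n<a rewrite ℕDM.m<n⇒m/n≡0 n<a =
    trans (cong +_ (ℕP.+-identityʳ (f n)))
    (trans (f≡F n)
           (sym (trans (at (⊛Geom-unfold F c) n)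
                       (trans (cong (ℤ._+_ (F n)) (shift-below (suc c) _ n n<a)) (ℤP.+-identityʳ _)))))
  ... | inj₂ (m , refl) =
    trans (cong +_ (multiplicitySum-step f c m))
    (trans (ℤP.pos-+ (f (suc c ℕ.+ m)) (multiplicitySum f c m))
           (sym (trans (at (⊛Geom-unfold F c) (suc c ℕ.+ m))
                       (cong₂ ℤ._+_ (sym (f≡F _))
                                    (trans (shift-at (suc c) _ m) (sym (ih (ℕP.m<n+m m (s≤s z≤n)))))))))

PartsUpTo OddPartsUpTo : ℕ → Series
PartsUpTo    = Prod 1 Geom 1
OddPartsUpTo = Prod 2 Geom 1

isZero-indicator : ∀ n → + (if n ℕ.≡ᵇ 0 then 1 else 0) ≡ 𝟙 n
isZero-indicator zero    = refl
isZero-indicator (suc n) = refl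

pParts≡PartsUpTo : ∀ k n → + pParts k n ≡ PartsUpTo k n
pParts≡PartsUpTo zero    n = isZero-indicator n
pParts≡PartsUpTo (suc k) n =
  trans (multiplicitySum≡⊛Geom (pParts k) (PartsUpTo k) (pParts≡PartsUpTo k) k n)
        (sym (at (≈-trans (Prod-snoc 1 Geom 1 k) (⊛-congˡ (PartsUpTo k) (≈-reflexive (cong Geom (1+1*k≡1+k k))))) n))
  where
  1+1*k≡1+k : ∀ k → 1 ℕ.+ 1 ℕ.* k ≡ suc k
  1+1*k≡1+k = ℕ-solve-∀

oParts≡OddPartsUpTo : ∀ k n → + oParts k n ≡ OddPartsUpTo k n
oParts≡OddPartsUpTo zero    n = isZero-indicator n
oParts≡OddPartsUpTo (suc k) n =
  trans (multiplicitySum≡⊛Geom (oParts k) (OddPartsUpTo k) (oParts≡OddPartsUpTo k) (2 ℕ.* k) n)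
        (sym (at (Prod-snoc 2 Geom 1 k) n))

PartsUpTo≡p : ∀ K m → m ℕ.≤ K → PartsUpTo K m ≡ p (+ m)
PartsUpTo≡p K m m≤K =
  sym (trans (pParts≡PartsUpTo m m)
      (trans (ProdGeom-stable 1 1 m (K ℕ.∸ m) (s≤s z≤n) m (s≤s (ℕP.m≤n*m m 1)))
             (cong (λ x → PartsUpTo x m) (ℕP.m∸n+n≡m m≤K))))

OddPartsUpTo≡pₒ : ∀ K m → m ℕ.≤ K → OddPartsUpTo K m ≡ pₒ (+ m)
OddPartsUpTo≡pₒ K m m≤K =
  sym (trans (oParts≡OddPartsUpTo m m)
      (trans (ProdGeom-stable 2 1 m (K ℕ.∸ m) (s≤s z≤n) m (s≤s (ℕP.m≤n*m m 2)))
             (cong (λ x → OddPartsUpTo x m) (ℕP.m∸n+n≡m m≤K))))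

OddPartsUpTo-split : ∀ M → OddPartsUpTo (2 ℕ.* M) ≈ Prod 4 Geom 1 M ⊛ Prod 4 Geom 3 M
OddPartsUpTo-split = Prod-interleave 2 Geom 1

PartsUpTo-split : ∀ M → PartsUpTo (4 ℕ.* M) ≈ (Prod 4 Geom 1 M ⊛ Prod 4 Geom 3 M) ⊛ (Prod 4 Geom 2 M ⊛ Prod 4 Geom 4 M)
PartsUpTo-split M =
  ≈-trans (≈-reflexive (cong PartsUpTo (4*≡2*2* M)))
  (≈-trans (Prod-interleave 1 Geom 1 (2 ℕ.* M))
           (⊛-cong (Prod-interleave 2 Geom 1 M) (Prod-interleave 2 Geom 2 M)))
  where
  4*≡2*2* : ∀ M → 4 ℕ.* M ≡ 2 ℕ.* (2 ℕ.* M)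
  4*≡2*2* = ℕ-solve-∀

-- The q-binomial theorem and a finite form of Gauss's identity

sgnₛ : ℕ → Series
sgnₛ zero    = 𝟙
sgnₛ (suc i) = ⊖ sgnₛ i

sgnₛ-square : ∀ a → sgnₛ a ⊛ sgnₛ a ≈ 𝟙
sgnₛ-square zero    = R.*-identityˡ 𝟙
sgnₛ-square (suc a) =
  ≈-trans (solve 1 (λ s → (:- s) :* (:- s) := s :* s) ≈-refl (sgnₛ a)) (sgnₛ-square a)

sgnₛ-+ : ∀ a b → sgnₛ (a ℕ.+ b) ≈ sgnₛ a ⊛ sgnₛ b
sgnₛ-+ zero    b = ≈-sym (R.*-identityˡ (sgnₛ b))
sgnₛ-+ (suc a) b = ≈-trans (R.-‿cong (sgnₛ-+ a b)) (≈-sym (R.-‿*-distribˡ (sgnₛ a) (sgnₛ b)))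

choose2 : ℕ → ℕ
choose2 zero    = 0
choose2 (suc i) = choose2 i ℕ.+ i

choose2-+ : ∀ a b → choose2 (a ℕ.+ b) ≡ choose2 a ℕ.+ choose2 b ℕ.+ a ℕ.* b
choose2-+ a zero    = trans (cong choose2 (ℕP.+-identityʳ a)) (sym (lemma (choose2 a) a))
  where
  lemma : ∀ t a → t ℕ.+ 0 ℕ.+ a ℕ.* 0 ≡ t
  lemma = ℕ-solve-∀
choose2-+ a (suc b) =
  trans (cong choose2 (ℕP.+-suc a b))
        (trans (cong (ℕ._+ (a ℕ.+ b)) (choose2-+ a b)) (lemma (choose2 a) (choose2 b) a b))
  where
  lemma : ∀ ta tb a b → ta ℕ.+ tb ℕ.+ a ℕ.* b ℕ.+ (a ℕ.+ b) ≡ ta ℕ.+ (tb ℕ.+ b) ℕ.+ a ℕ.* suc b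
  lemma = ℕ-solve-∀

choose2-double : ∀ t → 2 ℕ.* choose2 t ℕ.+ t ≡ t ℕ.* t
choose2-double zero    = refl
choose2-double (suc t) =
  trans (lemma₁ (choose2 t) t) (trans (cong (λ x → x ℕ.+ 2 ℕ.* t ℕ.+ 1) (choose2-double t)) (lemma₂ t))
  where
  lemma₁ : ∀ a t → 2 ℕ.* (a ℕ.+ t) ℕ.+ suc t ≡ 2 ℕ.* a ℕ.+ t ℕ.+ 2 ℕ.* t ℕ.+ 1
  lemma₁ = ℕ-solve-∀
  lemma₂ : ∀ t → t ℕ.* t ℕ.+ 2 ℕ.* t ℕ.+ 1 ≡ suc t ℕ.* suc t
  lemma₂ = ℕ-solve-∀

-- Gaussian binomial coefficients [M choose i] in the variable X^4 (q-Pascal recursion).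
qBinom : ℕ → ℕ → Series
qBinom zero    zero    = 𝟙
qBinom zero    (suc i) = 𝟘
qBinom (suc M) zero    = 𝟙
qBinom (suc M) (suc i) = qBinom M i ⊕ X^ (4 ℕ.* suc i) ⊛ qBinom M (suc i)

qBinom-0 : ∀ M → qBinom M 0 ≡ 𝟙
qBinom-0 zero    = refl
qBinom-0 (suc M) = refl

qBinom-above : ∀ M k → M ℕ.< k → qBinom M k ≈ 𝟘
qBinom-above zero    (suc i) _ = ≈-refl
qBinom-above (suc M) (suc i) (s≤s M<i) =
  ≈-trans (R.+-cong (qBinom-above M i M<i)
                    (⊛-congˡ (X^ (4 ℕ.* suc i)) (qBinom-above M (suc i) (ℕP.m<n⇒m<1+n M<i))))
          (≈-trans (R.+-identityˡ _) (R.zeroʳ _))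

DiffProduct : ℕ → ℕ → ℕ → Series
DiffProduct U X zero    = 𝟙
DiffProduct U X (suc M) = (X^ U ⊕ ⊖ X^ X) ⊛ DiffProduct U (X ℕ.+ 4) M

qBinomialExp : ℕ → ℕ → ℕ → ℕ → ℕ
qBinomialExp U X M i = X ℕ.* i ℕ.+ 4 ℕ.* choose2 i ℕ.+ U ℕ.* (M ℕ.∸ i)

qBinomialTerm : ℕ → ℕ → ℕ → ℕ → Series
qBinomialTerm U X M i = sgnₛ i ⊛ X^ (qBinomialExp U X M i) ⊛ qBinom M i

qBinomialSum : ℕ → ℕ → ℕ → Series
qBinomialSum U X M = Σₛ (suc M) (qBinomialTerm U X M)

qBinomialTerm-X : ∀ U X M i →
  sgnₛ (suc i) ⊛ X^ (qBinomialExp U X (suc M) (suc i)) ⊛ qBinom M i ≈ ⊖ (X^ X ⊛ qBinomialTerm U (X ℕ.+ 4) M i)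
qBinomialTerm-X U X M i =
  ≈-trans (⊛-congʳ (qBinom M i) (⊛-congˡ (sgnₛ (suc i))
            (≈-trans (X^-cong (exponent X i (choose2 i) U (M ℕ.∸ i))) (≈-sym (X^-+ X _)))))
          (solve 4 (λ s x y q → (:- s) :* (x :* y) :* q := :- (x :* (s :* y :* q)))
                 ≈-refl (sgnₛ i) (X^ X) (X^ (qBinomialExp U (X ℕ.+ 4) M i)) (qBinom M i))
  where
  exponent : ∀ X i t U w → X ℕ.* suc i ℕ.+ 4 ℕ.* (t ℕ.+ i) ℕ.+ U ℕ.* w ≡ X ℕ.+ ((X ℕ.+ 4) ℕ.* i ℕ.+ 4 ℕ.* t ℕ.+ U ℕ.* w)
  exponent = ℕ-solve-∀

qBinomialTerm-U : ∀ U X M i → i ℕ.< M →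
  sgnₛ (suc i) ⊛ X^ (qBinomialExp U X (suc M) (suc i)) ⊛ (X^ (4 ℕ.* suc i) ⊛ qBinom M (suc i))
  ≈ X^ U ⊛ qBinomialTerm U (X ℕ.+ 4) M (suc i)
qBinomialTerm-U U X M i i<M =
  ≈-trans (solve 4 (λ s x y q → s :* x :* (y :* q) := (x :* y) :* (s :* q)) ≈-refl (sgnₛ (suc i)) (X^ e) (X^ (4 ℕ.* suc i)) (qBinom M (suc i)))
  (≈-trans (⊛-congʳ (sgnₛ (suc i) ⊛ qBinom M (suc i)) (≈-trans (X^-+ e (4 ℕ.* suc i)) (≈-trans (X^-cong exponent) (≈-sym (X^-+ U e')))))
           (solve 4 (λ s x y q → (x :* y) :* (s :* q) := x :* (s :* y :* q)) ≈-refl (sgnₛ (suc i)) (X^ U) (X^ e') (qBinom M (suc i))))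
  where
  e  = qBinomialExp U X (suc M) (suc i)
  e' = qBinomialExp U (X ℕ.+ 4) M (suc i)
  exponent′ : ∀ X i t U w → X ℕ.* suc i ℕ.+ 4 ℕ.* (t ℕ.+ i) ℕ.+ U ℕ.* suc w ℕ.+ 4 ℕ.* suc i
                            ≡ U ℕ.+ ((X ℕ.+ 4) ℕ.* suc i ℕ.+ 4 ℕ.* (t ℕ.+ i) ℕ.+ U ℕ.* w)
  exponent′ = ℕ-solve-∀
  exponent : e ℕ.+ 4 ℕ.* suc i ≡ U ℕ.+ e'
  exponent = trans (cong (λ w → X ℕ.* suc i ℕ.+ 4 ℕ.* (choose2 i ℕ.+ i) ℕ.+ U ℕ.* w ℕ.+ 4 ℕ.* suc i) (ℕP.+-∸-assoc 1 i<M))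
                   (exponent′ X i (choose2 i) U (M ℕ.∸ suc i))

qBinomialTerm-U₀ : ∀ U X M → qBinomialTerm U X (suc M) 0 ≈ X^ U ⊛ qBinomialTerm U (X ℕ.+ 4) M 0
qBinomialTerm-U₀ U X M =
  ≈-trans (⊛-congˡ (sgnₛ 0 ⊛ X^ (qBinomialExp U X (suc M) 0)) (≈-reflexive (sym (qBinom-0 M))))
  (≈-trans (⊛-congʳ (qBinom M 0) (⊛-congˡ 𝟙 (≈-trans (X^-cong (exponent X U M)) (≈-sym (X^-+ U (qBinomialExp U (X ℕ.+ 4) M 0))))))
           (solve 4 (λ s x y q → s :* (x :* y) :* q := x :* (s :* y :* q)) ≈-refl 𝟙 (X^ U) (X^ (qBinomialExp U (X ℕ.+ 4) M 0)) (qBinom M 0)))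
  where
  exponent : ∀ X U M → X ℕ.* 0 ℕ.+ 4 ℕ.* 0 ℕ.+ U ℕ.* suc M ≡ U ℕ.+ ((X ℕ.+ 4) ℕ.* 0 ℕ.+ 4 ℕ.* 0 ℕ.+ U ℕ.* M)
  exponent = ℕ-solve-∀

DiffProduct≈qBinomialSum : ∀ M U X → DiffProduct U X M ≈ qBinomialSum U X M
DiffProduct≈qBinomialSum zero U X =
  ≈-sym (≈-trans (R.+-identityʳ _) (≈-trans (R.*-identityʳ _) (≈-trans (R.*-identityˡ _)
        (X^-cong (cong₂ (λ a b → a ℕ.+ 4 ℕ.* 0 ℕ.+ b) (ℕP.*-zeroʳ X) (ℕP.*-zeroʳ U))))))
DiffProduct≈qBinomialSum (suc M) U X = begin
  (X^ U ⊕ ⊖ X^ X) ⊛ DiffProduct U (X ℕ.+ 4) M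
    ≈⟨ ⊛-congˡ (X^ U ⊕ ⊖ X^ X) (DiffProduct≈qBinomialSum M U (X ℕ.+ 4)) ⟩
  (X^ U ⊕ ⊖ X^ X) ⊛ Σₛ (suc M) t'
    ≈⟨ solve 3 (λ u x s → (u :- x) :* s := u :* s :- x :* s) ≈-refl (X^ U) (X^ X) (Σₛ (suc M) t') ⟩
  X^ U ⊛ Σₛ (suc M) t' ⊕ ⊖ (X^ X ⊛ Σₛ (suc M) t')
    ≈⟨ R.+-cong (⊛-Σₛ (suc M) (X^ U) t') (R.-‿cong (⊛-Σₛ (suc M) (X^ X) t')) ⟩
  Σₛ (suc M) (λ i → X^ U ⊛ t' i) ⊕ ⊖ Σₛ (suc M) (λ i → X^ X ⊛ t' i)
    ≈⟨ R.+-cong (≈-sym U-part) (≈-sym X-part) ⟩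
  (t 0 ⊕ Σₛ (suc M) B) ⊕ Σₛ (suc M) A
    ≈⟨ solve 3 (λ a b c → (a :+ b) :+ c := a :+ (c :+ b)) ≈-refl (t 0) (Σₛ (suc M) B) (Σₛ (suc M) A) ⟩
  t 0 ⊕ (Σₛ (suc M) A ⊕ Σₛ (suc M) B)
    ≈⟨ ⊕-congˡ (t 0) (≈-sym (Σₛ-⊕ (suc M) A B)) ⟩
  t 0 ⊕ Σₛ (suc M) (λ i → A i ⊕ B i)
    ≈⟨ ⊕-congˡ (t 0) (Σₛ-cong (suc M) (λ i _ →
         ≈-sym (R.distribˡ (sgnₛ (suc i) ⊛ X^ (e (suc i))) (qBinom M i) (X^ (4 ℕ.* suc i) ⊛ qBinom M (suc i))))) ⟩
  qBinomialSum U X (suc M) ∎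
  where
  open import Relation.Binary.Reasoning.Setoid R.setoid
  e = qBinomialExp U X (suc M)
  t = qBinomialTerm U X (suc M)
  t' = qBinomialTerm U (X ℕ.+ 4) M
  A B : ℕ → Series
  A i = sgnₛ (suc i) ⊛ X^ (e (suc i)) ⊛ qBinom M i
  B i = sgnₛ (suc i) ⊛ X^ (e (suc i)) ⊛ (X^ (4 ℕ.* suc i) ⊛ qBinom M (suc i))
  X-part : Σₛ (suc M) A ≈ ⊖ Σₛ (suc M) (λ i → X^ X ⊛ t' i)
  X-part = ≈-trans (Σₛ-cong (suc M) (λ i _ → qBinomialTerm-X U X M i)) (Σₛ-⊖ (suc M) (λ i → X^ X ⊛ t' i))
  B-last : B M ≈ 𝟘
  B-last = ≈-trans (⊛-congˡ (sgnₛ (suc M) ⊛ X^ (e (suc M))) (⊛-congˡ (X^ (4 ℕ.* suc M)) (qBinom-above M (suc M) (ℕP.n<1+n M))))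
                   (≈-trans (⊛-congˡ (sgnₛ (suc M) ⊛ X^ (e (suc M))) (R.zeroʳ _)) (R.zeroʳ _))
  U-part : t 0 ⊕ Σₛ (suc M) B ≈ Σₛ (suc M) (λ i → X^ U ⊛ t' i)
  U-part = R.+-cong (qBinomialTerm-U₀ U X M)
             (≈-trans (Σₛ-last M B) (≈-trans (R.+-cong (Σₛ-cong M (qBinomialTerm-U U X M)) B-last) (R.+-identityʳ _)))

DiffProduct-cong : ∀ U {X X'} M → X ≡ X' → DiffProduct U X M ≈ DiffProduct U X' M
DiffProduct-cong U M refl = ≈-refl

DiffProduct-+ : ∀ a b U X → DiffProduct U X (a ℕ.+ b) ≈ DiffProduct U X a ⊛ DiffProduct U (X ℕ.+ 4 ℕ.* a) b
DiffProduct-+ zero    b U X = ≈-trans (DiffProduct-cong U b (sym (ℕP.+-identityʳ X))) (≈-sym (R.*-identityˡ _))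
DiffProduct-+ (suc a) b U X =
  ≈-trans (⊛-congˡ (X^ U ⊕ ⊖ X^ X) (DiffProduct-+ a b U (X ℕ.+ 4)))
  (≈-trans (≈-sym (R.*-assoc (X^ U ⊕ ⊖ X^ X) _ _))
           (⊛-congˡ (DiffProduct U X (suc a)) (DiffProduct-cong U b (offset X a))))
  where
  offset : ∀ X a → X ℕ.+ 4 ℕ.+ 4 ℕ.* a ≡ X ℕ.+ 4 ℕ.* suc a
  offset = ℕ-solve-∀

DiffProduct-below : ∀ M U X → X ℕ.+ 4 ℕ.* M ℕ.≤ U ℕ.+ 3 →
  DiffProduct U X M ≈ sgnₛ M ⊛ X^ (X ℕ.* M ℕ.+ 4 ℕ.* choose2 M) ⊛ Prod↓ 4 1-X^ (U ℕ.∸ X) M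
DiffProduct-below zero    U X _ =
  ≈-sym (≈-trans (R.*-identityʳ _) (≈-trans (R.*-identityˡ _) (X^-cong (trans (ℕP.+-identityʳ (X ℕ.* 0)) (ℕP.*-zeroʳ X)))))
DiffProduct-below (suc M) U X bound =
  ≈-trans (⊛-cong factor (DiffProduct-below M U (X ℕ.+ 4) bound'))
  (≈-trans (solve 6 (λ o x y s z p → (:- (x :* (o :- y))) :* (s :* z :* p) := (:- s) :* (x :* z) :* ((o :- y) :* p)) ≈-refl
                    𝟙 (X^ X) (X^ (U ℕ.∸ X)) (sgnₛ M) (X^ ((X ℕ.+ 4) ℕ.* M ℕ.+ 4 ℕ.* choose2 M)) (Prod↓ 4 1-X^ (U ℕ.∸ (X ℕ.+ 4)) M))
  (⊛-cong (⊛-congˡ (sgnₛ (suc M)) (≈-trans (X^-+ X _) (X^-cong (exponent X M (choose2 M)))))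
          (⊛-congˡ (1-X^ (U ℕ.∸ X)) (≈-reflexive (cong (λ c → Prod↓ 4 1-X^ c M) (sym (ℕP.∸-+-assoc U X 4)))))))
  where
  exponent : ∀ X M t → X ℕ.+ ((X ℕ.+ 4) ℕ.* M ℕ.+ 4 ℕ.* t) ≡ X ℕ.* suc M ℕ.+ 4 ℕ.* (t ℕ.+ M)
  exponent = ℕ-solve-∀
  offset : ∀ X M → X ℕ.+ 4 ℕ.+ 4 ℕ.* M ≡ X ℕ.+ 4 ℕ.* suc M
  offset = ℕ-solve-∀
  bound' : X ℕ.+ 4 ℕ.+ 4 ℕ.* M ℕ.≤ U ℕ.+ 3
  bound' = ℕP.≤-trans (ℕP.≤-reflexive (offset X M)) bound
  X≤U : X ℕ.≤ U
  X≤U = ℕP.+-cancelʳ-≤ 3 X U (ℕP.≤-trans (ℕP.+-monoʳ-≤ X (ℕP.≤-trans (ℕP.n≤1+n 3) (ℕP.m≤m*n 4 (suc M)))) bound)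
  factor : X^ U ⊕ ⊖ X^ X ≈ ⊖ (X^ X ⊛ 1-X^ (U ℕ.∸ X))
  factor = ≈-trans (⊕-congʳ (⊖ X^ X) (X^-split X U X≤U))
           (≈-trans (⊕-congˡ (X^ X ⊛ X^ (U ℕ.∸ X)) (R.-‿cong (≈-sym (R.*-identityʳ (X^ X)))))
                    (solve 3 (λ x y o → x :* y :- x :* o := :- (x :* (o :- y))) ≈-refl (X^ X) (X^ (U ℕ.∸ X)) 𝟙))

DiffProduct-above : ∀ M U X → U ℕ.< X → DiffProduct U X M ≈ X^ (U ℕ.* M) ⊛ Prod 4 1-X^ (X ℕ.∸ U) M
DiffProduct-above zero    U X _ = ≈-sym (≈-trans (R.*-identityʳ _) (X^-cong (ℕP.*-zeroʳ U)))
DiffProduct-above (suc M) U X U<X =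
  ≈-trans (⊛-cong factor (DiffProduct-above M U (X ℕ.+ 4) (ℕP.<-≤-trans U<X (ℕP.m≤m+n X 4))))
  (≈-trans (solve 4 (λ u l z p → (u :* l) :* (z :* p) := (u :* z) :* (l :* p)) ≈-refl
                    (X^ U) (1-X^ (X ℕ.∸ U)) (X^ (U ℕ.* M)) (Prod 4 1-X^ ((X ℕ.+ 4) ℕ.∸ U) M))
  (⊛-cong (≈-trans (X^-+ U (U ℕ.* M)) (X^-cong (sym (ℕP.*-suc U M))))
          (⊛-congˡ (1-X^ (X ℕ.∸ U)) (≈-reflexive (cong (λ c → Prod 4 1-X^ c M) (ℕP.+-∸-comm 4 (ℕP.<⇒≤ U<X)))))))
  where
  factor : X^ U ⊕ ⊖ X^ X ≈ X^ U ⊛ 1-X^ (X ℕ.∸ U)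
  factor = ≈-trans (⊕-congˡ (X^ U) (R.-‿cong (X^-split U X (ℕP.<⇒≤ U<X))))
           (≈-trans (⊕-congʳ (⊖ (X^ U ⊛ X^ (X ℕ.∸ U))) (≈-sym (R.*-identityʳ (X^ U))))
                    (solve 3 (λ u y o → u :* o :- u :* y := u :* (o :- y)) ≈-refl (X^ U) (X^ (X ℕ.∸ U)) 𝟙))

-- gaussExp⁺ τ = τ (2τ + 1) and gaussExp⁻ τ = τ (2τ - 1): the exponents of the Gauss series
-- Σ_{τ ∈ ℤ} (-1)^τ X^(τ(2τ+1)) at τ and at -τ.
gaussExp⁺ gaussExp⁻ : ℕ → ℕ
gaussExp⁺ t = 4 ℕ.* choose2 t ℕ.+ 3 ℕ.* t
gaussExp⁻ t = 4 ℕ.* choose2 t ℕ.+ t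

gaussExp⁺≡ : ∀ τ → gaussExp⁺ τ ≡ τ ℕ.* (2 ℕ.* τ ℕ.+ 1)
gaussExp⁺≡ τ = trans (lemma₁ (choose2 τ) τ) (trans (cong (λ x → 2 ℕ.* x ℕ.+ τ) (choose2-double τ)) (lemma₂ τ))
  where
  lemma₁ : ∀ t τ → 4 ℕ.* t ℕ.+ 3 ℕ.* τ ≡ 2 ℕ.* (2 ℕ.* t ℕ.+ τ) ℕ.+ τ
  lemma₁ = ℕ-solve-∀
  lemma₂ : ∀ τ → 2 ℕ.* (τ ℕ.* τ) ℕ.+ τ ≡ τ ℕ.* (2 ℕ.* τ ℕ.+ 1)
  lemma₂ = ℕ-solve-∀

gaussExp⁻≡ : ∀ τ → gaussExp⁻ (suc τ) ≡ suc τ ℕ.* (2 ℕ.* τ ℕ.+ 1)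
gaussExp⁻≡ τ = trans (lemma₁ (choose2 τ) τ) (trans (cong (λ x → 2 ℕ.* x ℕ.+ 3 ℕ.* τ ℕ.+ 1) (choose2-double τ)) (lemma₂ τ))
  where
  lemma₁ : ∀ t τ → 4 ℕ.* (t ℕ.+ τ) ℕ.+ suc τ ≡ 2 ℕ.* (2 ℕ.* t ℕ.+ τ) ℕ.+ 3 ℕ.* τ ℕ.+ 1
  lemma₁ = ℕ-solve-∀
  lemma₂ : ∀ τ → 2 ℕ.* (τ ℕ.* τ) ℕ.+ 3 ℕ.* τ ℕ.+ 1 ≡ suc τ ℕ.* (2 ℕ.* τ ℕ.+ 1)
  lemma₂ = ℕ-solve-∀

baseExp : ℕ → ℕ → ℕ
baseExp N U = 4 ℕ.* choose2 N ℕ.+ U ℕ.* N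

-- Both sides are shifted by τ so that U τ + τ = 4 N τ can be used without subtraction.
baseExp-⁺ : ∀ τ r N U → τ ℕ.+ r ≡ N → U ℕ.+ 1 ≡ 4 ℕ.* N →
  qBinomialExp U 0 (N ℕ.+ N) r ≡ baseExp N U ℕ.+ gaussExp⁺ τ
baseExp-⁺ τ r .(τ ℕ.+ r) U refl U+1≡4N = ℕP.+-cancelʳ-≡ τ _ _ (begin
    4 ℕ.* choose2 r ℕ.+ U ℕ.* ((τ ℕ.+ r ℕ.+ (τ ℕ.+ r)) ℕ.∸ r) ℕ.+ τ
      ≡⟨ cong (λ x → 4 ℕ.* choose2 r ℕ.+ U ℕ.* x ℕ.+ τ) remaining ⟩
    4 ℕ.* choose2 r ℕ.+ U ℕ.* (τ ℕ.+ r ℕ.+ τ) ℕ.+ τ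
      ≡⟨ collect (4 ℕ.* choose2 r) U τ r ⟩
    4 ℕ.* choose2 r ℕ.+ U ℕ.* (τ ℕ.+ r) ℕ.+ τ ℕ.* (U ℕ.+ 1)
      ≡⟨ cong (λ x → 4 ℕ.* choose2 r ℕ.+ U ℕ.* (τ ℕ.+ r) ℕ.+ τ ℕ.* x) U+1≡4N ⟩
    4 ℕ.* choose2 r ℕ.+ U ℕ.* (τ ℕ.+ r) ℕ.+ τ ℕ.* (4 ℕ.* (τ ℕ.+ r))
      ≡⟨ expand (4 ℕ.* choose2 r) U τ r ⟩
    4 ℕ.* choose2 r ℕ.+ U ℕ.* (τ ℕ.+ r) ℕ.+ 4 ℕ.* τ ℕ.* r ℕ.+ 4 ℕ.* (τ ℕ.* τ)
      ≡⟨ cong (λ x → 4 ℕ.* choose2 r ℕ.+ U ℕ.* (τ ℕ.+ r) ℕ.+ 4 ℕ.* τ ℕ.* r ℕ.+ 4 ℕ.* x) (sym (choose2-double τ)) ⟩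
    4 ℕ.* choose2 r ℕ.+ U ℕ.* (τ ℕ.+ r) ℕ.+ 4 ℕ.* τ ℕ.* r ℕ.+ 4 ℕ.* (2 ℕ.* choose2 τ ℕ.+ τ)
      ≡⟨ regroup (choose2 τ) (choose2 r) U τ r ⟩
    4 ℕ.* (choose2 τ ℕ.+ choose2 r ℕ.+ τ ℕ.* r) ℕ.+ U ℕ.* (τ ℕ.+ r) ℕ.+ gaussExp⁺ τ ℕ.+ τ
      ≡⟨ cong (λ x → 4 ℕ.* x ℕ.+ U ℕ.* (τ ℕ.+ r) ℕ.+ gaussExp⁺ τ ℕ.+ τ) (sym (choose2-+ τ r)) ⟩
    baseExp (τ ℕ.+ r) U ℕ.+ gaussExp⁺ τ ℕ.+ τ ∎)
  where
  open ≡-Reasoning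
  remaining : (τ ℕ.+ r ℕ.+ (τ ℕ.+ r)) ℕ.∸ r ≡ τ ℕ.+ r ℕ.+ τ
  remaining = trans (cong (ℕ._∸ r) (rearranged τ r)) (ℕP.m+n∸m≡n r (τ ℕ.+ r ℕ.+ τ))
    where
    rearranged : ∀ τ r → τ ℕ.+ r ℕ.+ (τ ℕ.+ r) ≡ r ℕ.+ (τ ℕ.+ r ℕ.+ τ)
    rearranged = ℕ-solve-∀
  collect : ∀ a U τ r → a ℕ.+ U ℕ.* (τ ℕ.+ r ℕ.+ τ) ℕ.+ τ ≡ a ℕ.+ U ℕ.* (τ ℕ.+ r) ℕ.+ τ ℕ.* (U ℕ.+ 1)
  collect = ℕ-solve-∀
  expand : ∀ a U τ r → a ℕ.+ U ℕ.* (τ ℕ.+ r) ℕ.+ τ ℕ.* (4 ℕ.* (τ ℕ.+ r)) ≡ a ℕ.+ U ℕ.* (τ ℕ.+ r) ℕ.+ 4 ℕ.* τ ℕ.* r ℕ.+ 4 ℕ.* (τ ℕ.* τ)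
  expand = ℕ-solve-∀
  regroup : ∀ tt tr U τ r → 4 ℕ.* tr ℕ.+ U ℕ.* (τ ℕ.+ r) ℕ.+ 4 ℕ.* τ ℕ.* r ℕ.+ 4 ℕ.* (2 ℕ.* tt ℕ.+ τ)
         ≡ 4 ℕ.* (tt ℕ.+ tr ℕ.+ τ ℕ.* r) ℕ.+ U ℕ.* (τ ℕ.+ r) ℕ.+ (4 ℕ.* tt ℕ.+ 3 ℕ.* τ) ℕ.+ τ
  regroup = ℕ-solve-∀

baseExp-⁻ : ∀ τ w N U → suc τ ℕ.+ w ≡ N → U ℕ.+ 1 ≡ 4 ℕ.* N →
  qBinomialExp U 0 (N ℕ.+ N) (suc N ℕ.+ τ) ≡ baseExp N U ℕ.+ gaussExp⁻ (suc τ)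
baseExp-⁻ τ w .(suc τ ℕ.+ w) U refl U+1≡4N = begin
    4 ℕ.* choose2 (suc N ℕ.+ τ) ℕ.+ U ℕ.* ((N ℕ.+ N) ℕ.∸ (suc N ℕ.+ τ))
      ≡⟨ cong₂ (λ x y → 4 ℕ.* choose2 x ℕ.+ U ℕ.* y) (index τ w) remaining ⟩
    4 ℕ.* choose2 (N ℕ.+ suc τ) ℕ.+ U ℕ.* w
      ≡⟨ cong (λ x → 4 ℕ.* x ℕ.+ U ℕ.* w) (choose2-+ N (suc τ)) ⟩
    4 ℕ.* (choose2 N ℕ.+ choose2 (suc τ) ℕ.+ N ℕ.* suc τ) ℕ.+ U ℕ.* w
      ≡⟨ collect (choose2 N) (choose2 (suc τ)) N (suc τ) U w ⟩
    4 ℕ.* choose2 N ℕ.+ 4 ℕ.* choose2 (suc τ) ℕ.+ suc τ ℕ.* (4 ℕ.* N) ℕ.+ U ℕ.* w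
      ≡⟨ cong (λ x → 4 ℕ.* choose2 N ℕ.+ 4 ℕ.* choose2 (suc τ) ℕ.+ suc τ ℕ.* x ℕ.+ U ℕ.* w) (sym U+1≡4N) ⟩
    4 ℕ.* choose2 N ℕ.+ 4 ℕ.* choose2 (suc τ) ℕ.+ suc τ ℕ.* (U ℕ.+ 1) ℕ.+ U ℕ.* w
      ≡⟨ expand (choose2 N) (choose2 (suc τ)) τ U w ⟩
    baseExp N U ℕ.+ gaussExp⁻ (suc τ) ∎
  where
  open ≡-Reasoning
  N = suc τ ℕ.+ w
  index : ∀ τ w → suc (suc τ ℕ.+ w) ℕ.+ τ ≡ suc τ ℕ.+ w ℕ.+ suc τ
  index = ℕ-solve-∀
  remaining : (N ℕ.+ N) ℕ.∸ (suc N ℕ.+ τ) ≡ w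
  remaining = trans (cong (ℕ._∸ (suc N ℕ.+ τ)) (rearranged τ w)) (ℕP.m+n∸m≡n (suc N ℕ.+ τ) w)
    where
    rearranged : ∀ τ w → suc τ ℕ.+ w ℕ.+ (suc τ ℕ.+ w) ≡ suc (suc τ ℕ.+ w) ℕ.+ τ ℕ.+ w
    rearranged = ℕ-solve-∀
  collect : ∀ tN ts N s U w → 4 ℕ.* (tN ℕ.+ ts ℕ.+ N ℕ.* s) ℕ.+ U ℕ.* w ≡ 4 ℕ.* tN ℕ.+ 4 ℕ.* ts ℕ.+ s ℕ.* (4 ℕ.* N) ℕ.+ U ℕ.* w
  collect = ℕ-solve-∀
  expand : ∀ tN ts τ U w → 4 ℕ.* tN ℕ.+ 4 ℕ.* ts ℕ.+ suc τ ℕ.* (U ℕ.+ 1) ℕ.+ U ℕ.* w ≡ 4 ℕ.* tN ℕ.+ U ℕ.* (suc τ ℕ.+ w) ℕ.+ (4 ℕ.* ts ℕ.+ suc τ)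
  expand = ℕ-solve-∀

X^⊛-cancel : ∀ a {f g} → X^ a ⊛ f ≈ X^ a ⊛ g → f ≈ g
X^⊛-cancel a {f} {g} p = shift-injective a (≈-trans (shift≈X^⊛ a f) (≈-trans p (≈-sym (shift≈X^⊛ a g))))

sgnₛ⊛-cancel : ∀ s {f g} → sgnₛ s ⊛ f ≈ sgnₛ s ⊛ g → f ≈ g
sgnₛ⊛-cancel s {f} {g} p = begin
  f                        ≈⟨ ≈-sym (R.*-identityˡ f) ⟩
  𝟙 ⊛ f                    ≈⟨ ⊛-congʳ f (≈-sym (sgnₛ-square s)) ⟩
  sgnₛ s ⊛ sgnₛ s ⊛ f      ≈⟨ R.*-assoc (sgnₛ s) (sgnₛ s) f ⟩
  sgnₛ s ⊛ (sgnₛ s ⊛ f)    ≈⟨ ⊛-congˡ (sgnₛ s) p ⟩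
  sgnₛ s ⊛ (sgnₛ s ⊛ g)    ≈⟨ ≈-sym (R.*-assoc (sgnₛ s) (sgnₛ s) g) ⟩
  sgnₛ s ⊛ sgnₛ s ⊛ g      ≈⟨ ⊛-congʳ g (sgnₛ-square s) ⟩
  𝟙 ⊛ g                    ≈⟨ R.*-identityˡ g ⟩
  g                        ∎
  where open import Relation.Binary.Reasoning.Setoid R.setoid

-- The finite form of Gauss's identity: with N = k + 1 and U = 4N - 1, the product
-- ∏_{i<2N} (X^U - X^(4i)) collapses against the odd-part factors to ± a monomial, while its
-- q-binomial expansion, reindexed around the middle term, is that monomial times Sum.
module FiniteGauss (k : ℕ) where

  N U E : ℕ
  N = suc k
  U = 4 ℕ.* k ℕ.+ 3
  E = baseExp N U

  U+1≡4N : U ℕ.+ 1 ≡ 4 ℕ.* N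
  U+1≡4N = lemma k
    where
    lemma : ∀ k → 4 ℕ.* k ℕ.+ 3 ℕ.+ 1 ≡ 4 ℕ.* suc k
    lemma = ℕ-solve-∀

  lead : Series
  lead = sgnₛ N ⊛ X^ E

  product-evaluation : DiffProduct U 0 (N ℕ.+ N) ⊛ OddPartsUpTo (2 ℕ.* N) ≈ lead
  product-evaluation =
    ≈-trans (⊛-cong (≈-trans (DiffProduct-+ N N U 0) (⊛-cong (DiffProduct-below N U 0 below) (DiffProduct-above N U (4 ℕ.* N) above)))
                    (≈-trans (OddPartsUpTo-split N) (⊛-congˡ (Prod 4 Geom 1 N) (≈-sym (Prod↓≈Prod Geom k)))))
    (≈-trans (solve 7 (λ s a d b i gi gd → (s :* a :* d) :* (b :* i) :* (gi :* gd) := (s :* (a :* b)) :* ((d :* gd) :* (i :* gi))) ≈-refl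
                      (sgnₛ N) (X^ (4 ℕ.* choose2 N)) (Prod↓ 4 1-X^ U N) (X^ (U ℕ.* N)) (Prod 4 1-X^ (4 ℕ.* N ℕ.∸ U) N)
                      (Prod 4 Geom 1 N) (Prod↓ 4 Geom U N))
    (≈-trans (⊛-cong (⊛-congˡ (sgnₛ N) (X^-+ (4 ℕ.* choose2 N) (U ℕ.* N)))
                     (≈-trans (⊛-cong down-inverse up-inverse) (R.*-identityˡ 𝟙)))
             (R.*-identityʳ _)))
    where
    below : 0 ℕ.+ 4 ℕ.* N ℕ.≤ U ℕ.+ 3
    below = ℕP.≤-trans (ℕP.≤-reflexive (sym U+1≡4N)) (ℕP.+-monoʳ-≤ U (s≤s z≤n))
    above : U ℕ.< 4 ℕ.* N
    above = ℕP.≤-reflexive (trans (ℕP.+-comm 1 U) U+1≡4N)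
    4N∸U≡1 : 4 ℕ.* N ℕ.∸ U ≡ 1
    4N∸U≡1 = trans (cong (ℕ._∸ U) (sym U+1≡4N)) (ℕP.m+n∸m≡n U 1)
    down-inverse : Prod↓ 4 1-X^ U N ⊛ Prod↓ 4 Geom U N ≈ 𝟙
    down-inverse = ≈-trans (⊛-cong (Prod↓≈Prod 1-X^ k) (Prod↓≈Prod Geom k)) (Prod-inverse 4 1-X^ Geom 1-X^⊛Geom 3 N (s≤s z≤n))
    up-inverse : Prod 4 1-X^ (4 ℕ.* N ℕ.∸ U) N ⊛ Prod 4 Geom 1 N ≈ 𝟙
    up-inverse = ≈-trans (≈-reflexive (cong (λ c → Prod 4 1-X^ c N ⊛ Prod 4 Geom 1 N) 4N∸U≡1))
                         (Prod-inverse 4 1-X^ Geom 1-X^⊛Geom 1 N (s≤s z≤n))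

  term⁺ term⁻ : ℕ → Series
  term⁺ τ = sgnₛ τ ⊛ X^ (gaussExp⁺ τ) ⊛ qBinom (N ℕ.+ N) (N ℕ.∸ τ)
  term⁻ τ = ⊖ sgnₛ τ ⊛ X^ (gaussExp⁻ (suc τ)) ⊛ qBinom (N ℕ.+ N) (suc N ℕ.+ τ)

  Sum : Series
  Sum = Σₛ (suc N) term⁺ ⊕ Σₛ N term⁻

  reindex⁺ : ∀ τ → τ ℕ.< suc N → qBinomialTerm U 0 (N ℕ.+ N) (N ℕ.∸ τ) ≈ lead ⊛ term⁺ τ
  reindex⁺ τ (s≤s τ≤N) with ℕP.m≤n⇒∃[o]m+o≡n τ≤N
  ... | r , τ+r≡N =
    ≈-trans (⊛-congʳ (qBinom (N ℕ.+ N) (N ℕ.∸ τ)) (⊛-cong sign (≈-trans (X^-cong exponent) (≈-sym (X^-+ E (gaussExp⁺ τ))))))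
            (solve 5 (λ s t x y q → (s :* t) :* (x :* y) :* q := s :* x :* (t :* y :* q)) ≈-refl
                     (sgnₛ N) (sgnₛ τ) (X^ E) (X^ (gaussExp⁺ τ)) (qBinom (N ℕ.+ N) (N ℕ.∸ τ)))
    where
    N∸τ≡r : N ℕ.∸ τ ≡ r
    N∸τ≡r = trans (cong (ℕ._∸ τ) (sym τ+r≡N)) (ℕP.m+n∸m≡n τ r)
    exponent : qBinomialExp U 0 (N ℕ.+ N) (N ℕ.∸ τ) ≡ E ℕ.+ gaussExp⁺ τ
    exponent = trans (cong (qBinomialExp U 0 (N ℕ.+ N)) N∸τ≡r) (baseExp-⁺ τ r N U τ+r≡N U+1≡4N)
    sign : sgnₛ (N ℕ.∸ τ) ≈ sgnₛ N ⊛ sgnₛ τ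
    sign = ≈-trans (≈-reflexive (cong sgnₛ N∸τ≡r)) (≈-sym
             (≈-trans (⊛-congʳ (sgnₛ τ) (≈-trans (≈-reflexive (cong sgnₛ (sym τ+r≡N))) (sgnₛ-+ τ r)))
             (≈-trans (solve 2 (λ a b → a :* b :* a := b :* (a :* a)) ≈-refl (sgnₛ τ) (sgnₛ r))
             (≈-trans (⊛-congˡ (sgnₛ r) (sgnₛ-square τ)) (R.*-identityʳ (sgnₛ r))))))

  reindex⁻ : ∀ τ → τ ℕ.< N → qBinomialTerm U 0 (N ℕ.+ N) (suc N ℕ.+ τ) ≈ lead ⊛ term⁻ τ
  reindex⁻ τ τ<N with ℕP.m≤n⇒∃[o]m+o≡n τ<N
  ... | w , τ+w≡N =
    ≈-trans (⊛-congʳ (qBinom (N ℕ.+ N) (suc N ℕ.+ τ))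
              (⊛-cong (R.-‿cong (sgnₛ-+ N τ))
                      (≈-trans (X^-cong (baseExp-⁻ τ w N U τ+w≡N U+1≡4N)) (≈-sym (X^-+ E (gaussExp⁻ (suc τ)))))))
            (solve 5 (λ s t x y q → (:- (s :* t)) :* (x :* y) :* q := s :* x :* ((:- t) :* y :* q)) ≈-refl
                     (sgnₛ N) (sgnₛ τ) (X^ E) (X^ (gaussExp⁻ (suc τ))) (qBinom (N ℕ.+ N) (suc N ℕ.+ τ)))

  qBinomialSum≈lead⊛Sum : qBinomialSum U 0 (N ℕ.+ N) ≈ lead ⊛ Sum
  qBinomialSum≈lead⊛Sum =
    ≈-trans (Σₛ-+ (suc N) N t)
    (≈-trans (⊕-congʳ (Σₛ N (λ τ → t (suc N ℕ.+ τ))) (Σₛ-reverse (suc N) t))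
    (≈-trans (R.+-cong (Σₛ-cong (suc N) reindex⁺) (Σₛ-cong N reindex⁻))
    (≈-trans (R.+-cong (≈-sym (⊛-Σₛ (suc N) lead term⁺)) (≈-sym (⊛-Σₛ N lead term⁻)))
             (≈-sym (R.distribˡ lead (Σₛ (suc N) term⁺) (Σₛ N term⁻))))))
    where t = qBinomialTerm U 0 (N ℕ.+ N)

  Sum⊛OddParts : Sum ⊛ OddPartsUpTo (2 ℕ.* N) ≈ 𝟙
  Sum⊛OddParts = X^⊛-cancel E (sgnₛ⊛-cancel N (begin
    sgnₛ N ⊛ (X^ E ⊛ (Sum ⊛ O))
      ≈⟨ solve 4 (λ s x t o → s :* (x :* (t :* o)) := s :* x :* t :* o) ≈-refl (sgnₛ N) (X^ E) Sum O ⟩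
    lead ⊛ Sum ⊛ O
      ≈⟨ ⊛-congʳ O (≈-sym qBinomialSum≈lead⊛Sum) ⟩
    qBinomialSum U 0 (N ℕ.+ N) ⊛ O
      ≈⟨ ⊛-congʳ O (≈-sym (DiffProduct≈qBinomialSum (N ℕ.+ N) U 0)) ⟩
    DiffProduct U 0 (N ℕ.+ N) ⊛ O
      ≈⟨ product-evaluation ⟩
    lead
      ≈⟨ ≈-sym (⊛-congˡ (sgnₛ N) (R.*-identityʳ (X^ E))) ⟩
    sgnₛ N ⊛ (X^ E ⊛ 𝟙) ∎))
    where
    open import Relation.Binary.Reasoning.Setoid R.setoid
    O = OddPartsUpTo (2 ℕ.* N)

-- Truncation to Gauss's identity

ProdGeom4-snoc : ∀ j → Prod 4 Geom 4 (suc j) ≈ Prod 4 Geom 4 j ⊛ Geom (4 ℕ.* suc j)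
ProdGeom4-snoc j = ≈-trans (Prod-snoc 4 Geom 4 j) (⊛-congˡ _ (≈-reflexive (cong Geom (sym (ℕP.*-suc 4 j)))))

qBinom≈[]ProdGeom : ∀ M j → j ℕ.≤ M → qBinom M j ≈[ 4 ℕ.* (M ℕ.∸ j) ℕ.+ 4 ] Prod 4 Geom 4 j
qBinom≈[]ProdGeom zero    zero    _ n _ = refl
qBinom≈[]ProdGeom (suc M) zero    _ n _ = refl
qBinom≈[]ProdGeom (suc M) (suc j) (s≤s j≤M) =
  ≈[]-trans (≈[]-⊕ (qBinom≈[]ProdGeom M j j≤M) second) (≈⇒≈[] _ (≈-sym unfold))
  where
  B = Prod 4 Geom 4
  K = 4 ℕ.* (M ℕ.∸ j) ℕ.+ 4
  unfold : B (suc j) ≈ B j ⊕ X^ (4 ℕ.* suc j) ⊛ B (suc j)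
  unfold = ≈-trans (ProdGeom4-snoc j)
           (≈-trans (⊛Geom-unfold (B j) (j ℕ.+ 3 ℕ.* suc j))
                    (⊕-congˡ (B j) (≈-trans (shift≈X^⊛ (4 ℕ.* suc j) _) (⊛-congˡ _ (≈-sym (ProdGeom4-snoc j))))))
  second : X^ (4 ℕ.* suc j) ⊛ qBinom M (suc j) ≈[ K ] X^ (4 ℕ.* suc j) ⊛ B (suc j)
  second with ℕP.m≤n⇒m<n∨m≡n j≤M
  ... | inj₁ j<M = ≈[]-weaken bound (≈[]-X^⊛ (4 ℕ.* suc j) (qBinom≈[]ProdGeom M (suc j) j<M))
    where
    split : ∀ j w → 4 ℕ.* suc j ℕ.+ (4 ℕ.* w ℕ.+ 4) ≡ 4 ℕ.* j ℕ.+ (4 ℕ.* (1 ℕ.+ w) ℕ.+ 4)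
    split = ℕ-solve-∀
    bound : K ℕ.≤ 4 ℕ.* suc j ℕ.+ (4 ℕ.* (M ℕ.∸ suc j) ℕ.+ 4)
    bound = ℕP.≤-trans (ℕP.≤-reflexive (cong (λ x → 4 ℕ.* x ℕ.+ 4) (ℕP.+-∸-assoc 1 j<M)))
              (ℕP.≤-trans (ℕP.m≤n+m _ (4 ℕ.* j)) (ℕP.≤-reflexive (sym (split j (M ℕ.∸ suc j)))))
  ... | inj₂ refl = λ n n<K →
    trans (X^⊛≈[]𝟘 (4 ℕ.* suc j) _ n (bound n n<K)) (sym (X^⊛≈[]𝟘 (4 ℕ.* suc j) _ n (bound n n<K)))
    where
    bound : ∀ n → n ℕ.< K → n ℕ.< 4 ℕ.* suc j
    bound n n<K = ℕP.<-≤-trans n<K (ℕP.≤-trans (ℕP.≤-reflexive (cong (λ x → 4 ℕ.* x ℕ.+ 4) (ℕP.n∸n≡0 j))) (ℕP.*-monoʳ-≤ 4 (s≤s z≤n)))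

X^⊛qBinom≈[] : ∀ e M j {K} → j ℕ.≤ M → K ℕ.≤ e ℕ.+ (4 ℕ.* (M ℕ.∸ j) ℕ.+ 4) → K ℕ.≤ e ℕ.+ (4 ℕ.+ 4 ℕ.* j) →
               X^ e ⊛ qBinom M j ≈[ K ] X^ e ⊛ Prod 4 Geom 4 M
X^⊛qBinom≈[] e M j j≤M bound₁ bound₂ =
  ≈[]-trans (≈[]-weaken bound₁ (≈[]-X^⊛ e (qBinom≈[]ProdGeom M j j≤M)))
            (≈[]-weaken bound₂ (≈[]-X^⊛ e (λ m m< → trans (ProdGeom-stable 4 4 j (M ℕ.∸ j) (s≤s z≤n) m m<)
                                                        (cong (λ x → Prod 4 Geom 4 x m) (ℕP.m∸n+n≡m j≤M)))))

gaussExp⁺-≥ : ∀ τ → τ ℕ.≤ gaussExp⁺ τ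
gaussExp⁺-≥ τ = ℕP.≤-trans (ℕP.m≤n*m τ 3) (ℕP.m≤n+m (3 ℕ.* τ) (4 ℕ.* choose2 τ))

gaussExp⁻-≥ : ∀ τ → τ ℕ.≤ gaussExp⁻ τ
gaussExp⁻-≥ τ = ℕP.m≤n+m τ (4 ℕ.* choose2 τ)

≤4*+4 : ∀ x → x ℕ.≤ 4 ℕ.* x ℕ.+ 4
≤4*+4 x = ℕP.≤-trans (ℕP.m≤n*m x 4) (ℕP.m≤m+n _ 4)

≤4+4* : ∀ x → x ℕ.≤ 4 ℕ.+ 4 ℕ.* x
≤4+4* x = ℕP.≤-trans (ℕP.m≤n*m x 4) (ℕP.m≤n+m _ 4)

-- In degrees ≤ n the q-binomials in FiniteGauss.Sum can be replaced by their limits, which turns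
-- Sum into the truncated Gauss series GaussPoly times 1/((1 - X^4) ⋯ (1 - X^(8N))).
module GaussTruncation (n : ℕ) where

  open FiniteGauss n public

  B : Series
  B = Prod 4 Geom 4 (N ℕ.+ N)

  mono⁺ mono⁻ : ℕ → Series
  mono⁺ τ = sgnₛ τ ⊛ X^ (gaussExp⁺ τ)
  mono⁻ τ = ⊖ sgnₛ τ ⊛ X^ (gaussExp⁻ (suc τ))

  GaussPoly : Series
  GaussPoly = Σₛ (suc N) mono⁺ ⊕ Σₛ N mono⁻

  term≈[] : ∀ s e j {K} → j ℕ.≤ N ℕ.+ N →
            K ℕ.≤ e ℕ.+ (4 ℕ.* (N ℕ.+ N ℕ.∸ j) ℕ.+ 4) → K ℕ.≤ e ℕ.+ (4 ℕ.+ 4 ℕ.* j) →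
            s ⊛ X^ e ⊛ qBinom (N ℕ.+ N) j ≈[ K ] s ⊛ X^ e ⊛ B
  term≈[] s e j j≤ bound₁ bound₂ =
    ≈[]-trans (≈⇒≈[] _ (R.*-assoc s _ _))
    (≈[]-trans (≈[]-⊛ˡ s (X^⊛qBinom≈[] e (N ℕ.+ N) j j≤ bound₁ bound₂)) (≈⇒≈[] _ (≈-sym (R.*-assoc s _ _))))

  term⁺≈[] : ∀ τ → τ ℕ.< suc N → term⁺ τ ≈[ N ] mono⁺ τ ⊛ B
  term⁺≈[] τ (s≤s τ≤N) = term≈[] (sgnₛ τ) (gaussExp⁺ τ) r r≤2N bound₁ bound₂
    where
    r = N ℕ.∸ τ
    r≤N : r ℕ.≤ N
    r≤N = ℕP.m∸n≤m N τ
    r≤2N : r ℕ.≤ N ℕ.+ N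
    r≤2N = ℕP.≤-trans r≤N (ℕP.m≤m+n N N)
    N≤2N∸r : N ℕ.≤ N ℕ.+ N ℕ.∸ r
    N≤2N∸r = ℕP.≤-trans (ℕP.≤-reflexive (sym (ℕP.m+n∸n≡m N N))) (ℕP.∸-monoʳ-≤ (N ℕ.+ N) r≤N)
    bound₁ : N ℕ.≤ gaussExp⁺ τ ℕ.+ (4 ℕ.* (N ℕ.+ N ℕ.∸ r) ℕ.+ 4)
    bound₁ = ℕP.≤-trans N≤2N∸r (ℕP.≤-trans (≤4*+4 _) (ℕP.m≤n+m _ (gaussExp⁺ τ)))
    bound₂ : N ℕ.≤ gaussExp⁺ τ ℕ.+ (4 ℕ.+ 4 ℕ.* r)
    bound₂ = ℕP.≤-trans (ℕP.≤-reflexive (sym (ℕP.m+[n∸m]≡n τ≤N))) (ℕP.+-mono-≤ (gaussExp⁺-≥ τ) (≤4+4* r))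

  term⁻≈[] : ∀ τ → τ ℕ.< N → term⁻ τ ≈[ N ] mono⁻ τ ⊛ B
  term⁻≈[] τ τ<N with ℕP.m≤n⇒∃[o]m+o≡n τ<N
  ... | w , τ+w≡N = term≈[] (⊖ sgnₛ τ) (gaussExp⁻ (suc τ)) j j≤2N bound₁ bound₂
    where
    j = suc N ℕ.+ τ
    regroup : ∀ N τ w → N ℕ.+ (suc τ ℕ.+ w) ≡ suc N ℕ.+ τ ℕ.+ w
    regroup = ℕ-solve-∀
    2N≡j+w : N ℕ.+ N ≡ j ℕ.+ w
    2N≡j+w = trans (cong (N ℕ.+_) (sym τ+w≡N)) (regroup N τ w)
    j≤2N : j ℕ.≤ N ℕ.+ N
    j≤2N = ℕP.≤-trans (ℕP.m≤m+n j w) (ℕP.≤-reflexive (sym 2N≡j+w))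
    2N∸j≡w : N ℕ.+ N ℕ.∸ j ≡ w
    2N∸j≡w = trans (cong (ℕ._∸ j) 2N≡j+w) (ℕP.m+n∸m≡n j w)
    bound₁ : N ℕ.≤ gaussExp⁻ (suc τ) ℕ.+ (4 ℕ.* (N ℕ.+ N ℕ.∸ j) ℕ.+ 4)
    bound₁ = ℕP.≤-trans (ℕP.≤-reflexive (sym τ+w≡N))
               (ℕP.+-mono-≤ (gaussExp⁻-≥ (suc τ)) (ℕP.≤-trans (≤4*+4 w) (ℕP.≤-reflexive (cong (λ x → 4 ℕ.* x ℕ.+ 4) (sym 2N∸j≡w)))))
    bound₂ : N ℕ.≤ gaussExp⁻ (suc τ) ℕ.+ (4 ℕ.+ 4 ℕ.* j)
    bound₂ = ℕP.≤-trans (ℕP.≤-trans (ℕP.n≤1+n N) (ℕP.m≤m+n (suc N) τ)) (ℕP.≤-trans (≤4+4* j) (ℕP.m≤n+m _ _))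

  Sum≈[]GaussPoly⊛B : Sum ≈[ N ] GaussPoly ⊛ B
  Sum≈[]GaussPoly⊛B =
    ≈[]-trans (≈[]-⊕ (Σₛ-≈[] (suc N) term⁺≈[]) (Σₛ-≈[] N term⁻≈[]))
              (≈⇒≈[] _ (≈-sym (≈-trans (R.distribʳ B (Σₛ (suc N) mono⁺) (Σₛ N mono⁻))
                                       (R.+-cong (Σₛ-⊛ (suc N) B mono⁺) (Σₛ-⊛ N B mono⁻)))))

  O : Series
  O = OddPartsUpTo (2 ℕ.* N)

  GaussPoly⊛O⊛B≈[]𝟙 : GaussPoly ⊛ O ⊛ B ≈[ N ] 𝟙
  GaussPoly⊛O⊛B≈[]𝟙 =
    ≈[]-trans (≈⇒≈[] _ (solve 3 (λ p o b → p :* o :* b := p :* b :* o) ≈-refl GaussPoly O B))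
    (≈[]-trans (≈[]-⊛ʳ O (≈[]-sym Sum≈[]GaussPoly⊛B)) (≈⇒≈[] _ Sum⊛OddParts))

  GaussPoly⊛OddParts≈[] : GaussPoly ⊛ O ≈[ N ] Prod 4 1-X^ 4 (N ℕ.+ N)
  GaussPoly⊛OddParts≈[] =
    ≈[]-trans (≈⇒≈[] _ (begin
      GaussPoly ⊛ O                   ≈⟨ ≈-sym (R.*-identityʳ _) ⟩
      GaussPoly ⊛ O ⊛ 𝟙
        ≈⟨ ⊛-congˡ _ (≈-sym (≈-trans (R.*-comm B F) (Prod-inverse 4 1-X^ Geom 1-X^⊛Geom 4 (N ℕ.+ N) (s≤s z≤n)))) ⟩
      GaussPoly ⊛ O ⊛ (B ⊛ F)         ≈⟨ ≈-sym (R.*-assoc _ B F) ⟩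
      GaussPoly ⊛ O ⊛ B ⊛ F           ∎))
    (≈[]-trans (≈[]-⊛ʳ F GaussPoly⊛O⊛B≈[]𝟙) (≈⇒≈[] _ (R.*-identityˡ F)))
    where
    open import Relation.Binary.Reasoning.Setoid R.setoid
    F = Prod 4 1-X^ 4 (N ℕ.+ N)

  GaussPoly⊛Parts≈[] : GaussPoly ⊛ PartsUpTo (4 ℕ.* N) ≈[ N ] Prod 4 Geom 2 N
  GaussPoly⊛Parts≈[] =
    ≈[]-trans (≈⇒≈[] _ (≈-trans (⊛-congˡ GaussPoly (≈-trans (PartsUpTo-split N) (⊛-congʳ _ (≈-sym (OddPartsUpTo-split N)))))
                                (solve 4 (λ p o e f → p :* (o :* (e :* f)) := p :* o :* f :* e) ≈-refl GaussPoly O (Prod 4 Geom 2 N) (Prod 4 Geom 4 N))))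
    (≈[]-trans (≈[]-⊛ʳ (Prod 4 Geom 2 N) (≈[]-⊛ˡ (GaussPoly ⊛ O) (≈[]-weaken (≤4+4* N) (ProdGeom-stable 4 4 N N (s≤s z≤n)))))
    (≈[]-trans (≈[]-⊛ʳ (Prod 4 Geom 2 N) GaussPoly⊛O⊛B≈[]𝟙) (≈⇒≈[] _ (R.*-identityˡ _))))

Σℤ : ℕ → (ℕ → ℤ) → ℤ
Σℤ zero    g = + 0
Σℤ (suc k) g = g 0 ℤ.+ Σℤ k (g ∘ suc)

Σℤ-cong : ∀ k {g h} → (∀ i → i ℕ.< k → g i ≡ h i) → Σℤ k g ≡ Σℤ k h
Σℤ-cong zero    e = refl
Σℤ-cong (suc k) e = cong₂ ℤ._+_ (e 0 (s≤s z≤n)) (Σℤ-cong k (λ i i<k → e (suc i) (s≤s i<k)))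

Σℤ-last : ∀ k g → Σℤ (suc k) g ≡ Σℤ k g ℤ.+ g k
Σℤ-last zero    g = trans (ℤP.+-identityʳ (g 0)) (sym (ℤP.+-identityˡ (g 0)))
Σℤ-last (suc k) g = trans (cong (ℤ._+_ (g 0)) (Σℤ-last k (g ∘ suc))) (sym (ℤP.+-assoc (g 0) _ _))

Σℤ-+ : ∀ k g h → Σℤ k (λ i → g i ℤ.+ h i) ≡ Σℤ k g ℤ.+ Σℤ k h
Σℤ-+ zero    g h = refl
Σℤ-+ (suc k) g h = trans (cong (ℤ._+_ (g 0 ℤ.+ h 0)) (Σℤ-+ k (g ∘ suc) (h ∘ suc))) (ℤ+-interchange (g 0) (h 0) _ _)

Σₛ-at : ∀ k h n → Σₛ k h n ≡ Σℤ k (λ τ → h τ n)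
Σₛ-at zero    h n = refl
Σₛ-at (suc k) h n = cong (ℤ._+_ (h 0 n)) (Σₛ-at k (h ∘ suc) n)

foldr≡Σℤ : ∀ (g : ℕ → ℤ) (h : ℕ → ℕ) k → foldr ℤ._+_ (+ 0) (map g (applyUpTo h k)) ≡ Σℤ k (g ∘ h)
foldr≡Σℤ g h zero    = refl
foldr≡Σℤ g h (suc k) = cong (ℤ._+_ (g (h 0))) (foldr≡Σℤ g (h ∘ suc) k)

altSumTerm : (ℤ → ℤ) → ℕ → ℕ → ℤ
altSumTerm f n τ = sgn τ ℤ.* (f (+ n ℤ.- + (τ ℕ.* (2 ℕ.* τ ℕ.+ 1))) ℤ.- f (+ n ℤ.- + (suc τ ℕ.* (2 ℕ.* τ ℕ.+ 1))))

altSum≡Σℤ : ∀ f ν n → altSum f ν n ≡ Σℤ ν (altSumTerm f n)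
altSum≡Σℤ f ν n = foldr≡Σℤ (altSumTerm f n) (λ x → x) ν

-- The ν-th symmetric partial sum of Σ_{τ ∈ ℤ} (-1)^τ f(n - τ(2τ+1)).
gaussPartialSum : (ℤ → ℤ) → ℕ → ℕ → ℤ
gaussPartialSum f ν n = altSum f ν n ℤ.+ sgn ν ℤ.* f (+ n ℤ.- + (ν ℕ.* (2 ℕ.* ν ℕ.+ 1)))

sgnₛ⊛-at : ∀ τ H n → (sgnₛ τ ⊛ H) n ≡ sgn τ ℤ.* H n
sgnₛ⊛-at zero    H n = trans (⊛-identityˡ-at H n) (sym (ℤP.*-identityˡ (H n)))
sgnₛ⊛-at (suc τ) H n =
  trans (neg-⊛-at (sgnₛ τ) H n) (trans (cong ℤ.-_ (sgnₛ⊛-at τ H n)) (ℤP.neg-distribˡ-* (sgn τ) (H n)))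

+-+≡+ : ∀ a m → + (a ℕ.+ m) ℤ.- + a ≡ + m
+-+≡+ a m = trans (cong (ℤ._- + a) (ℤP.pos-+ a m)) (cancel (+ a) (+ m))
  where
  cancel : ∀ a b → a ℤ.+ b ℤ.- a ≡ b
  cancel = ℤ-solve-∀

+-+≡-[1+] : ∀ n d → + n ℤ.- + (suc n ℕ.+ d) ≡ -[1+ d ]
+-+≡-[1+] n d =
  trans (ℤP.⊖-< (ℕP.m≤m+n (suc n) d))
        (cong (λ x → ℤ.- (+ x)) (trans (cong (ℕ._∸ n) (sym (ℕP.+-suc n d))) (ℕP.m+n∸m≡n n (suc d))))

X^⊛-at : ∀ (f : ℤ → ℤ) → (∀ j → f -[1+ j ] ≡ + 0) →
         ∀ e F n → (∀ m → m ℕ.≤ n → F m ≡ f (+ m)) → (X^ e ⊛ F) n ≡ f (+ n ℤ.- + e)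
X^⊛-at f f-neg e F n F≡f = trans (sym (at (shift≈X^⊛ e F) n)) (shift-eval (below-or-offset e n))
  where
  shift-eval : n ℕ.< e ⊎ Σ ℕ (λ m → e ℕ.+ m ≡ n) → shift e F n ≡ f (+ n ℤ.- + e)
  shift-eval (inj₁ n<e) with ℕP.m≤n⇒∃[o]m+o≡n n<e
  ... | d , refl = trans (shift-below (suc n ℕ.+ d) F n n<e) (trans (sym (f-neg d)) (cong f (sym (+-+≡-[1+] n d))))
  shift-eval (inj₂ (m , refl)) =
    trans (shift-at e F m) (trans (F≡f m (ℕP.m≤n+m m e)) (cong f (sym (+-+≡+ e m))))

module _ (n : ℕ) where

  open GaussTruncation n

  GaussPoly⊛-at : ∀ (f : ℤ → ℤ) → (∀ j → f -[1+ j ] ≡ + 0) →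
                  ∀ F → (∀ m → m ℕ.≤ n → F m ≡ f (+ m)) → (GaussPoly ⊛ F) n ≡ gaussPartialSum f N n
  GaussPoly⊛-at f f-neg F F≡f = begin
    (GaussPoly ⊛ F) n
      ≡⟨ at (≈-trans (R.distribʳ F (Σₛ (suc N) mono⁺) (Σₛ N mono⁻)) (R.+-cong (Σₛ-⊛ (suc N) F mono⁺) (Σₛ-⊛ N F mono⁻))) n ⟩
    Σₛ (suc N) (λ τ → mono⁺ τ ⊛ F) n ℤ.+ Σₛ N (λ τ → mono⁻ τ ⊛ F) n
      ≡⟨ cong₂ ℤ._+_ (trans (Σₛ-at (suc N) (λ τ → mono⁺ τ ⊛ F) n) (Σℤ-cong (suc N) (λ τ _ → value⁺ τ)))
                     (trans (Σₛ-at N (λ τ → mono⁻ τ ⊛ F) n) (Σℤ-cong N (λ τ _ → value⁻ τ))) ⟩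
    Σℤ (suc N) a ℤ.+ Σℤ N b
      ≡⟨ cong (ℤ._+ Σℤ N b) (Σℤ-last N a) ⟩
    Σℤ N a ℤ.+ a N ℤ.+ Σℤ N b
      ≡⟨ rearrange (Σℤ N a) (a N) (Σℤ N b) ⟩
    (Σℤ N a ℤ.+ Σℤ N b) ℤ.+ a N
      ≡⟨ cong (ℤ._+ a N) (sym (Σℤ-+ N a b)) ⟩
    Σℤ N (λ τ → a τ ℤ.+ b τ) ℤ.+ a N
      ≡⟨ cong (ℤ._+ a N) (trans (Σℤ-cong N (λ τ _ → factor (sgn τ) (f⁺ τ) (f⁻ τ))) (sym (altSum≡Σℤ f N n))) ⟩
    gaussPartialSum f N n ∎
    where
    open ≡-Reasoning
    f⁺ f⁻ a b : ℕ → ℤ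
    f⁺ τ = f (+ n ℤ.- + (τ ℕ.* (2 ℕ.* τ ℕ.+ 1)))
    f⁻ τ = f (+ n ℤ.- + (suc τ ℕ.* (2 ℕ.* τ ℕ.+ 1)))
    a τ = sgn τ ℤ.* f⁺ τ
    b τ = sgn (suc τ) ℤ.* f⁻ τ
    value : ∀ s e eᶠ → e ≡ eᶠ → (sgnₛ s ⊛ X^ e ⊛ F) n ≡ sgn s ℤ.* f (+ n ℤ.- + eᶠ)
    value s e eᶠ refl = trans (at (R.*-assoc (sgnₛ s) (X^ e) F) n)
                              (trans (sgnₛ⊛-at s _ n) (cong (sgn s ℤ.*_) (X^⊛-at f f-neg e F n F≡f)))
    value⁺ : ∀ τ → (mono⁺ τ ⊛ F) n ≡ a τ
    value⁺ τ = value τ (gaussExp⁺ τ) _ (gaussExp⁺≡ τ)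
    value⁻ : ∀ τ → (mono⁻ τ ⊛ F) n ≡ b τ
    value⁻ τ = value (suc τ) (gaussExp⁻ (suc τ)) _ (gaussExp⁻≡ τ)
    rearrange : ∀ x y z → x ℤ.+ y ℤ.+ z ≡ (x ℤ.+ z) ℤ.+ y
    rearrange = ℤ-solve-∀
    factor : ∀ s u v → s ℤ.* u ℤ.+ ℤ.- s ℤ.* v ≡ s ℤ.* (u ℤ.- v)
    factor = ℤ-solve-∀

≤-*suc : ∀ c {m n} .{{_ : ℕ.NonZero c}} → m ℕ.≤ n → m ℕ.≤ c ℕ.* suc n
≤-*suc c {n = n} m≤n = ℕP.≤-trans m≤n (ℕP.≤-trans (ℕP.n≤1+n n) (ℕP.m≤n*m (suc n) c))

gaussPartialSum-pₒ-odd : ∀ n → isEven n ≡ false → gaussPartialSum pₒ (suc n) n ≡ + 0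
gaussPartialSum-pₒ-odd n odd =
  trans (sym (GaussPoly⊛-at n pₒ (λ _ → refl) (OddPartsUpTo (2 ℕ.* suc n))
                            (λ m m≤n → OddPartsUpTo≡pₒ _ m (≤-*suc 2 m≤n))))
  (trans (GaussTruncation.GaussPoly⊛OddParts≈[] n n (ℕP.n<1+n n))
         (EvenSupported-Prod 4 1-X^ refl EvenSupported-1-X^ 4 (suc n ℕ.+ suc n) refl n odd))

module _ (n : ℕ) where

  private
    coefficient : gaussPartialSum p (suc n) n ≡ Prod 4 Geom 2 (suc n) n
    coefficient =
      trans (sym (GaussPoly⊛-at n p (λ _ → refl) (PartsUpTo (4 ℕ.* suc n))
                                (λ m m≤n → PartsUpTo≡p _ m (≤-*suc 4 m≤n))))
            (GaussTruncation.GaussPoly⊛Parts≈[] n n (ℕP.n<1+n n))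

  gaussPartialSum-p-odd : isEven n ≡ false → gaussPartialSum p (suc n) n ≡ + 0
  gaussPartialSum-p-odd odd = trans coefficient (EvenSupported-Prod 4 Geom refl EvenSupported-Geom 2 (suc n) refl n odd)

  gaussPartialSum-p-nonNeg : + 0 ℤ.≤ gaussPartialSum p (suc n) n
  gaussPartialSum-p-nonNeg = subst (+ 0 ℤ.≤_) (sym coefficient) (NonNeg-Prod 4 Geom NonNeg-Geom 2 (suc n) n)

-- Monotonicity of p and pₒ, and alternating tails

1≤i-j⇒j<i : ∀ {i j} → + 1 ℤ.≤ i ℤ.- j → j ℤ.< i
1≤i-j⇒j<i {i} {j} 1≤i-j =
  subst₂ ℤ._<_ (ℤP.+-identityˡ j) (cancel i j) (ℤP.+-monoˡ-< j (ℤP.<-≤-trans (ℤ.+<+ (s≤s z≤n)) 1≤i-j))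
  where
  cancel : ∀ i j → i ℤ.- j ℤ.+ j ≡ i
  cancel = ℤ-solve-∀

i-j≤i′ : ∀ i {j} → + 0 ℤ.≤ j → i ℤ.- j ℤ.≤ i
i-j≤i′ i 0≤j = subst (i ℤ.- _ ℤ.≤_) (ℤP.+-identityʳ i) (ℤP.+-monoʳ-≤ i (ℤP.neg-mono-≤ 0≤j))

i<j⇒0<j-i : ∀ {i j} → i ℤ.< j → + 0 ℤ.< j ℤ.- i
i<j⇒0<j-i {i} {j} i<j = subst (ℤ._< j ℤ.- i) (ℤP.+-inverseʳ i) (ℤP.+-monoˡ-< (ℤ.- i) i<j)

0<i-j⇒j<i : ∀ {i j} → + 0 ℤ.< i ℤ.- j → j ℤ.< i
0<i-j⇒j<i {i} {j} 0<i-j = subst₂ ℤ._<_ (ℤP.+-identityˡ j) (cancel i j) (ℤP.+-monoˡ-< j 0<i-j)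
  where
  cancel : ∀ i j → i ℤ.- j ℤ.+ j ≡ i
  cancel = ℤ-solve-∀

1-X^⊛-at : ∀ a F m → (1-X^ a ⊛ F) (a ℕ.+ m) ≡ F (a ℕ.+ m) ℤ.- F m
1-X^⊛-at a F m =
  trans (at (≈-trans (solve 3 (λ o x f → (o :- x) :* f := o :* f :- x :* f) ≈-refl 𝟙 (X^ a) F)
                     (R.+-cong (R.*-identityˡ F) (R.-‿cong (≈-sym (shift≈X^⊛ a F))))) (a ℕ.+ m))
        (cong (ℤ._-_ (F (a ℕ.+ m))) (shift-at a F m))

Geom⊛-increment : ∀ a H → 1 ℕ.≤ a → ∀ m → (Geom a ⊛ H) (a ℕ.+ m) ℤ.- (Geom a ⊛ H) m ≡ H (a ℕ.+ m)
Geom⊛-increment a H 1≤a m =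
  trans (sym (1-X^⊛-at a (Geom a ⊛ H) m))
        (at (≈-trans (≈-sym (R.*-assoc (1-X^ a) (Geom a) H)) (≈-trans (⊛-congʳ H (1-X^⊛Geom a 1≤a)) (R.*-identityˡ H))) (a ℕ.+ m))

Geom⊛-mono : ∀ a H → 1 ℕ.≤ a → NonNeg H → ∀ m → (Geom a ⊛ H) m ℤ.≤ (Geom a ⊛ H) (a ℕ.+ m)
Geom⊛-mono a H 1≤a nonNeg m = ℤP.0≤i-j⇒j≤i (subst (+ 0 ℤ.≤_) (sym (Geom⊛-increment a H 1≤a m)) (nonNeg (a ℕ.+ m)))

-- Geom 1 has all coefficients 1, so Geom 1 ⊛ Q ≥ Q 0 everywhere.
Geom⊛Geom1⊛-strictMono : ∀ a Q → 1 ℕ.≤ a → NonNeg Q → Q 0 ≡ + 1 →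
  ∀ m → (Geom a ⊛ (Geom 1 ⊛ Q)) m ℤ.< (Geom a ⊛ (Geom 1 ⊛ Q)) (a ℕ.+ m)
Geom⊛Geom1⊛-strictMono a Q 1≤a nonNeg Q₀≡1 m =
  1≤i-j⇒j<i (subst (+ 1 ℤ.≤_) (sym (Geom⊛-increment a (Geom 1 ⊛ Q) 1≤a m)) positive)
  where
  positive : + 1 ℤ.≤ (Geom 1 ⊛ Q) (a ℕ.+ m)
  positive = subst (ℤ._≤ (Geom 1 ⊛ Q) (a ℕ.+ m)) (cong₂ ℤ._*_ (Geom1-at (a ℕ.+ m)) Q₀≡1)
                   (⊛-lowerBound (Geom 1) Q (NonNeg-Geom 1) nonNeg (a ℕ.+ m))

p-mono : ∀ m → p (+ m) ℤ.≤ p (+ suc m)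
p-mono m =
  subst₂ ℤ._≤_ (PartsUpTo≡p (suc m) m (ℕP.n≤1+n m)) (PartsUpTo≡p (suc m) (suc m) ℕP.≤-refl)
         (Geom⊛-mono 1 (Prod 1 Geom 2 m) (s≤s z≤n) (NonNeg-Prod 1 Geom NonNeg-Geom 2 m) m)

p-<-+3 : ∀ m → p (+ m) ℤ.< p (+ (3 ℕ.+ m))
p-<-+3 m =
  subst₂ ℤ._<_ (trans (sym (at reorder m)) (PartsUpTo≡p (3 ℕ.+ m) m (ℕP.m≤n+m m 3)))
               (trans (sym (at reorder (3 ℕ.+ m))) (PartsUpTo≡p (3 ℕ.+ m) (3 ℕ.+ m) ℕP.≤-refl))
         (Geom⊛Geom1⊛-strictMono 3 Q (s≤s z≤n) (NonNeg-⊛ (NonNeg-Geom 2) (NonNeg-Prod 1 Geom NonNeg-Geom 4 m))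
                                 (cong (ℤ._*_ (+ 1)) (Prod-head 1 Geom Geom-head 4 m)) m)
  where
  Q : Series
  Q = Geom 2 ⊛ Prod 1 Geom 4 m
  reorder : PartsUpTo (3 ℕ.+ m) ≈ Geom 3 ⊛ (Geom 1 ⊛ Q)
  reorder = solve 4 (λ a b c r → a :* (b :* (c :* r)) := c :* (a :* (b :* r))) ≈-refl (Geom 1) (Geom 2) (Geom 3) (Prod 1 Geom 4 m)

pₒ-mono : ∀ m → pₒ (+ m) ℤ.≤ pₒ (+ suc m)
pₒ-mono m =
  subst₂ ℤ._≤_ (OddPartsUpTo≡pₒ (suc m) m (ℕP.n≤1+n m)) (OddPartsUpTo≡pₒ (suc m) (suc m) ℕP.≤-refl)
         (Geom⊛-mono 1 (Prod 2 Geom 3 m) (s≤s z≤n) (NonNeg-Prod 2 Geom NonNeg-Geom 3 m) m)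

pₒ-<-+3 : ∀ m → pₒ (+ m) ℤ.< pₒ (+ (3 ℕ.+ m))
pₒ-<-+3 m =
  subst₂ ℤ._<_ (trans (sym (at reorder m)) (OddPartsUpTo≡pₒ (3 ℕ.+ m) m (ℕP.m≤n+m m 3)))
               (trans (sym (at reorder (3 ℕ.+ m))) (OddPartsUpTo≡pₒ (3 ℕ.+ m) (3 ℕ.+ m) ℕP.≤-refl))
         (Geom⊛Geom1⊛-strictMono 3 Q (s≤s z≤n) (NonNeg-Prod 2 Geom NonNeg-Geom 5 (suc m))
                                 (Prod-head 2 Geom Geom-head 5 (suc m)) m)
  where
  Q : Series
  Q = Prod 2 Geom 5 (suc m)
  reorder : OddPartsUpTo (3 ℕ.+ m) ≈ Geom 3 ⊛ (Geom 1 ⊛ Q)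
  reorder = solve 3 (λ a c r → a :* (c :* r) := c :* (a :* r)) ≈-refl (Geom 1) (Geom 3) Q

module AlternatingTail (h U : ℕ → ℤ) (h-mono : ∀ k → h (suc k) ℤ.≤ h k) (h-nonNeg : ∀ k → + 0 ℤ.≤ h k)
                       (U-rec : ∀ k → U k ≡ h k ℤ.- U (suc k)) where

  U-bounds : ∀ d k → U (k ℕ.+ d) ≡ + 0 → + 0 ℤ.≤ U k × U k ℤ.≤ h k
  U-bounds zero k U≡0 rewrite ℕP.+-identityʳ k | U≡0 = ℤP.≤-refl , h-nonNeg k
  U-bounds (suc d) k U≡0 with U-bounds d (suc k) (trans (cong U (sym (ℕP.+-suc k d))) U≡0)
  ... | 0≤U′ , U′≤h′ rewrite U-rec k = ℤP.i≤j⇒0≤j-i (ℤP.≤-trans U′≤h′ (h-mono k)) , i-j≤i′ (h k) 0≤U′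

  U-positive : ∀ d k → U (suc k ℕ.+ d) ≡ + 0 → h (suc k) ℤ.< h k → + 0 ℤ.< U k
  U-positive d k U≡0 h′<h rewrite U-rec k = i<j⇒0<j-i (ℤP.≤-<-trans (proj₂ (U-bounds d (suc k) U≡0)) h′<h)

record IncreasingCount (f : ℤ → ℤ) : Set where
  field
    vanishes : ∀ j → f -[1+ j ] ≡ + 0
    at-0     : f (+ 0) ≡ + 1
    mono     : ∀ m → f (+ m) ℤ.≤ f (+ suc m)
    <-+3     : ∀ m → f (+ m) ℤ.< f (+ (3 ℕ.+ m))

p-increasing : IncreasingCount p
p-increasing = record { vanishes = λ _ → refl ; at-0 = refl ; mono = p-mono ; <-+3 = p-<-+3 }

pₒ-increasing : IncreasingCount pₒ
pₒ-increasing = record { vanishes = λ _ → refl ; at-0 = refl ; mono = pₒ-mono ; <-+3 = pₒ-<-+3 }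

module IncreasingCountProperties {f : ℤ → ℤ} (inc : IncreasingCount f) where

  open IncreasingCount inc

  mono-+ : ∀ a d → f (+ a) ℤ.≤ f (+ (d ℕ.+ a))
  mono-+ a zero    = ℤP.≤-refl
  mono-+ a (suc d) = ℤP.≤-trans (mono-+ a d) (mono (d ℕ.+ a))

  positive : ∀ a → + 1 ℤ.≤ f (+ a)
  positive a = subst₂ ℤ._≤_ at-0 (cong (f ∘ +_) (ℕP.+-identityʳ a)) (mono-+ 0 a)

  nonNeg : ∀ x → + 0 ℤ.≤ f x
  nonNeg (+ a)    = ℤP.≤-trans (ℤ.+≤+ z≤n) (positive a)
  nonNeg -[1+ j ] = ℤP.≤-reflexive (sym (vanishes j))

  monotone : ∀ {x y} → x ℤ.≤ y → f x ℤ.≤ f y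
  monotone { -[1+ j ]} {y} _ = subst (ℤ._≤ f y) (sym (vanishes j)) (nonNeg y)
  monotone {+ a} {+ b} (ℤ.+≤+ a≤b) with ℕP.m≤n⇒∃[o]m+o≡n a≤b
  ... | d , refl = subst (λ x → f (+ a) ℤ.≤ f (+ x)) (ℕP.+-comm d a) (mono-+ a d)

  strict : ∀ x a → x ℤ.+ + 3 ℤ.≤ + a → f x ℤ.< f (+ a)
  strict -[1+ j ] a _ = subst (ℤ._< f (+ a)) (sym (vanishes j)) (ℤP.<-≤-trans (ℤ.+<+ (s≤s z≤n)) (positive a))
  strict (+ b)    a b+3≤a =
    ℤP.<-≤-trans (<-+3 b) (monotone (subst (ℤ._≤ + a) (trans (sym (ℤP.pos-+ b 3)) (cong +_ (ℕP.+-comm b 3))) b+3≤a))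

sgn-square : ∀ k → sgn k ℤ.* sgn k ≡ + 1
sgn-square zero    = refl
sgn-square (suc k) = trans (neg-square (sgn k)) (sgn-square k)
  where
  neg-square : ∀ s → ℤ.- s ℤ.* ℤ.- s ≡ s ℤ.* s
  neg-square = ℤ-solve-∀

module AlternatingSumBound {f : ℤ → ℤ} (inc : IncreasingCount f) (n : ℕ) where

  open IncreasingCount inc
  open IncreasingCountProperties inc

  b c h V U : ℕ → ℤ
  b k = f (+ n ℤ.- + (k ℕ.* (2 ℕ.* k ℕ.+ 1)))
  c k = f (+ n ℤ.- + (suc k ℕ.* (2 ℕ.* k ℕ.+ 1)))
  h k = c k ℤ.+ b (suc k)
  V k = gaussPartialSum f k n
  U k = sgn k ℤ.* (V k ℤ.- V (suc n))

  V-step : ∀ k → V (suc k) ≡ V k ℤ.+ sgn (suc k) ℤ.* h k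
  V-step k =
    trans (cong (ℤ._+ sgn (suc k) ℤ.* b (suc k))
                (trans (altSum≡Σℤ f (suc k) n) (trans (Σℤ-last k (altSumTerm f n)) (cong (ℤ._+ altSumTerm f n k) (sym (altSum≡Σℤ f k n))))))
          (regroup (altSum f k n) (sgn k) (b k) (c k) (b (suc k)))
    where
    regroup : ∀ A s x y z → A ℤ.+ s ℤ.* (x ℤ.- y) ℤ.+ ℤ.- s ℤ.* z ≡ A ℤ.+ s ℤ.* x ℤ.+ ℤ.- s ℤ.* (y ℤ.+ z)
    regroup = ℤ-solve-∀

  f-antitone : ∀ {e e'} → e ℕ.≤ e' → f (+ n ℤ.- + e') ℤ.≤ f (+ n ℤ.- + e)
  f-antitone e≤e' = monotone (ℤP.+-monoʳ-≤ (+ n) (ℤP.neg-mono-≤ (ℤ.+≤+ e≤e')))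

  f-vanishes : ∀ e → n ℕ.< e → f (+ n ℤ.- + e) ≡ + 0
  f-vanishes e n<e with ℕP.m≤n⇒∃[o]m+o≡n n<e
  ... | d , refl = trans (cong f (+-+≡-[1+] n d)) (vanishes d)

  b-antitone : ∀ k → b (suc k) ℤ.≤ b k
  b-antitone k = f-antitone (ℕP.*-mono-≤ (ℕP.n≤1+n k) (ℕP.+-monoˡ-≤ 1 (ℕP.*-monoʳ-≤ 2 (ℕP.n≤1+n k))))

  c-antitone : ∀ k → c (suc k) ℤ.≤ c k
  c-antitone k = f-antitone (ℕP.*-mono-≤ (ℕP.n≤1+n (suc k)) (ℕP.+-monoˡ-≤ 1 (ℕP.*-monoʳ-≤ 2 (ℕP.n≤1+n k))))

  h-nonNeg : ∀ k → + 0 ℤ.≤ h k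
  h-nonNeg k = ℤP.+-mono-≤ (nonNeg _) (nonNeg _)

  h-mono : ∀ k → h (suc k) ℤ.≤ h k
  h-mono k = ℤP.+-mono-≤ (c-antitone k) (b-antitone (suc k))

  c-strict : ∀ k → suc k ℕ.* (2 ℕ.* k ℕ.+ 1) ℕ.≤ n → c (suc k) ℤ.< c k
  c-strict k e≤n with ℕP.m≤n⇒∃[o]m+o≡n e≤n
  ... | m , refl = subst (c (suc k) ℤ.<_) (sym (cong f (+-+≡+ e m))) (strict _ m bound)
    where
    e = suc k ℕ.* (2 ℕ.* k ℕ.+ 1)
    d = 4 ℕ.* k ℕ.+ 2
    next-exponent : ∀ k → suc (suc k) ℕ.* (2 ℕ.* suc k ℕ.+ 1) ≡ suc k ℕ.* (2 ℕ.* k ℕ.+ 1) ℕ.+ 3 ℕ.+ (4 ℕ.* k ℕ.+ 2)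
    next-exponent = ℕ-solve-∀
    shifted : ∀ E M D → E ℤ.+ M ℤ.- (E ℤ.+ + 3 ℤ.+ D) ℤ.+ + 3 ≡ M ℤ.- D
    shifted = ℤ-solve-∀
    bound : + (e ℕ.+ m) ℤ.- + (suc (suc k) ℕ.* (2 ℕ.* suc k ℕ.+ 1)) ℤ.+ + 3 ℤ.≤ + m
    bound = subst (ℤ._≤ + m)
              (sym (trans (cong (λ x → + (e ℕ.+ m) ℤ.- + x ℤ.+ + 3) (next-exponent k))
                   (trans (cong₂ (λ x y → x ℤ.- y ℤ.+ + 3) (ℤP.pos-+ e m) (trans (ℤP.pos-+ (e ℕ.+ 3) d) (cong (ℤ._+ + d) (ℤP.pos-+ e 3))))
                          (shifted (+ e) (+ m) (+ d)))))
              (i-j≤i′ (+ m) {+ d} (ℤ.+≤+ z≤n))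

  h-strict : ∀ k → suc k ℕ.* (2 ℕ.* k ℕ.+ 1) ℕ.≤ n → h (suc k) ℤ.< h k
  h-strict k e≤n = ℤP.+-mono-<-≤ (c-strict k e≤n) (b-antitone (suc k))

  h-vanishes : ∀ k → n ℕ.≤ k → h k ≡ + 0
  h-vanishes k n≤k = cong₂ ℤ._+_ (f-vanishes _ (ℕP.<-≤-trans (s≤s n≤k) (at-least k k)))
                                 (f-vanishes _ (ℕP.<-≤-trans (s≤s n≤k) (at-least k (suc k))))
    where
    at-least : ∀ k m → suc k ℕ.≤ suc k ℕ.* (2 ℕ.* m ℕ.+ 1)
    at-least k m = ℕP.≤-trans (ℕP.≤-reflexive (sym (ℕP.*-identityʳ (suc k)))) (ℕP.*-monoʳ-≤ (suc k) (ℕP.m≤n+m 1 (2 ℕ.* m)))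

  V-stable : ∀ d → V (d ℕ.+ suc n) ≡ V (suc n)
  V-stable zero    = refl
  V-stable (suc d) =
    trans (V-step (d ℕ.+ suc n))
          (trans (cong (λ x → V (d ℕ.+ suc n) ℤ.+ sgn (suc (d ℕ.+ suc n)) ℤ.* x)
                       (h-vanishes _ (ℕP.≤-trans (ℕP.n≤1+n n) (ℕP.m≤n+m (suc n) d))))
                 (trans (cong (ℤ._+_ (V (d ℕ.+ suc n))) (ℤP.*-zeroʳ (sgn (suc (d ℕ.+ suc n)))))
                        (trans (ℤP.+-identityʳ _) (V-stable d))))

  U-rec : ∀ k → U k ≡ h k ℤ.- U (suc k)
  U-rec k = sym (trans (cong (λ x → h k ℤ.- ℤ.- sgn k ℤ.* (x ℤ.- V (suc n))) (V-step k))
                       (trans (expand (sgn k) (V k) (h k) (V (suc n)))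
                              (trans (cong (λ x → U k ℤ.+ (+ 1 ℤ.- x) ℤ.* h k) (sgn-square k))
                                     (trans (cong (ℤ._+_ (U k)) (ℤP.*-zeroˡ (h k))) (ℤP.+-identityʳ (U k))))))
    where
    expand : ∀ s v x w → x ℤ.- ℤ.- s ℤ.* (v ℤ.+ ℤ.- s ℤ.* x ℤ.- w) ≡ s ℤ.* (v ℤ.- w) ℤ.+ (+ 1 ℤ.- s ℤ.* s) ℤ.* x
    expand = ℤ-solve-∀

  U-vanishes : ∀ k → U (k ℕ.+ suc n) ≡ + 0
  U-vanishes k =
    trans (cong (λ x → sgn (k ℕ.+ suc n) ℤ.* (x ℤ.- V (suc n))) (V-stable k))
          (trans (cong (ℤ._*_ (sgn (k ℕ.+ suc n))) (ℤP.+-inverseʳ (V (suc n)))) (ℤP.*-zeroʳ (sgn (k ℕ.+ suc n))))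

  open AlternatingTail h U h-mono h-nonNeg U-rec

  sign-identity : ∀ ν → b (suc ν) ℤ.- sgn ν ℤ.* altSum f (suc ν) n ≡ U (suc ν) ℤ.+ sgn (suc ν) ℤ.* V (suc n)
  sign-identity ν =
    sym (trans (expand (sgn ν) (altSum f (suc ν) n) (b (suc ν)) (V (suc n)))
               (trans (cong (λ x → x ℤ.* b (suc ν) ℤ.- sgn ν ℤ.* altSum f (suc ν) n) (sgn-square ν))
                      (cong (ℤ._- sgn ν ℤ.* altSum f (suc ν) n) (ℤP.*-identityˡ (b (suc ν))))))
    where
    expand : ∀ s A x w → ℤ.- s ℤ.* (A ℤ.+ ℤ.- s ℤ.* x ℤ.- w) ℤ.+ ℤ.- s ℤ.* w ≡ s ℤ.* s ℤ.* x ℤ.- s ℤ.* A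
    expand = ℤ-solve-∀

  bound : ∀ ν → + 0 ℤ.≤ sgn (suc ν) ℤ.* V (suc n) →
          (sgn ν ℤ.* altSum f (suc ν) n ℤ.≤ b (suc ν))
          × (suc ν ℕ.* (2 ℕ.* suc ν ℕ.+ 3) ℕ.< n → sgn ν ℤ.* altSum f (suc ν) n ℤ.< b (suc ν))
  bound ν 0≤limit =
      ℤP.0≤i-j⇒j≤i (subst (+ 0 ℤ.≤_) (sym (sign-identity ν))
                          (ℤP.+-mono-≤ (proj₁ (U-bounds (suc n) (suc ν) (U-vanishes (suc ν)))) 0≤limit))
    , λ large → 0<i-j⇒j<i (subst (+ 0 ℤ.<_) (sym (sign-identity ν))
                                 (ℤP.+-mono-<-≤ (U-positive n (suc ν) U≡0 (h-strict (suc ν) (below large))) 0≤limit))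
    where
    U≡0 : U (suc (suc ν) ℕ.+ n) ≡ + 0
    U≡0 = trans (cong U (sym (ℕP.+-suc (suc ν) n))) (U-vanishes (suc ν))
    next : ∀ ν → suc (suc ν) ℕ.* (2 ℕ.* suc ν ℕ.+ 1) ≡ suc (suc ν ℕ.* (2 ℕ.* suc ν ℕ.+ 3))
    next = ℕ-solve-∀
    below : suc ν ℕ.* (2 ℕ.* suc ν ℕ.+ 3) ℕ.< n → suc (suc ν) ℕ.* (2 ℕ.* suc ν ℕ.+ 1) ℕ.≤ n
    below large = ℕP.≤-trans (ℕP.≤-reflexive (next ν)) large

%2≡ : ∀ n → n % 2 ≡ (if isEven n then 0 else 1)
%2≡ zero          = refl
%2≡ (suc zero)    = refl
%2≡ (suc (suc n)) =
  trans (cong (_% 2) (ℕP.+-comm 2 n))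
        (trans (ℕDM.[m+n]%n≡m%n n 2) (trans (%2≡ n) (cong (λ e → if e then 0 else 1) (sym (not-involutive (isEven n))))))

odd⇒¬isEven : ∀ n → n % 2 ≡ 1 → isEven n ≡ false
odd⇒¬isEven n odd with isEven n | %2≡ n
... | true  | n%2≡0 with () ← trans (sym n%2≡0) odd
... | false | _     = refl

even⇒sgn≡1 : ∀ n → n % 2 ≡ 0 → sgn n ≡ + 1
even⇒sgn≡1 n even = sgn-by-parity n (trans (sym (%2≡ n)) even)
  where
  sgn-by-parity : ∀ n → (if isEven n then 0 else 1) ≡ 0 → sgn n ≡ + 1
  sgn-by-parity zero          _ = refl
  sgn-by-parity (suc zero)    ()
  sgn-by-parity (suc (suc n)) e =
    trans (ℤP.neg-involutive (sgn n))
          (sgn-by-parity n (trans (cong (λ x → if x then 0 else 1) (sym (not-involutive (isEven n)))) e))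

0≤sgn*0 : ∀ k {x} → x ≡ + 0 → + 0 ≤ sgn k ℤ.* x
0≤sgn*0 k refl = ℤP.≤-reflexive (sym (ℤP.*-zeroʳ (sgn k)))

corollary3p2 : (ν n : ℕ) → 1 ℕ.≤ ν →
  ((n % 2 ≡ 1 ⊎ ν % 2 ≡ 0) →
    (sgn (ν ℕ.∸ 1) ℤ.* altSum p ν n ≤ p (+ n - + (ν ℕ.* (2 ℕ.* ν ℕ.+ 1))))
    × (ν ℕ.* (2 ℕ.* ν ℕ.+ 3) ℕ.< n →
        sgn (ν ℕ.∸ 1) ℤ.* altSum p ν n < p (+ n - + (ν ℕ.* (2 ℕ.* ν ℕ.+ 1)))))
  × (n % 2 ≡ 1 →
    (sgn (ν ℕ.∸ 1) ℤ.* altSum pₒ ν n ≤ pₒ (+ n - + (ν ℕ.* (2 ℕ.* ν ℕ.+ 1))))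
    × (ν ℕ.* (2 ℕ.* ν ℕ.+ 3) ℕ.< n →
        sgn (ν ℕ.∸ 1) ℤ.* altSum pₒ ν n < pₒ (+ n - + (ν ℕ.* (2 ℕ.* ν ℕ.+ 1)))))
corollary3p2 (suc ν) n _ =
    (λ { (inj₁ odd)  → AlternatingSumBound.bound p-increasing n ν
                         (0≤sgn*0 (suc ν) (gaussPartialSum-p-odd n (odd⇒¬isEven n odd)))
       ; (inj₂ even) → AlternatingSumBound.bound p-increasing n ν
                         (subst (λ s → + 0 ≤ s ℤ.* gaussPartialSum p (suc n) n) (sym (even⇒sgn≡1 (suc ν) even))
                                (subst (+ 0 ≤_) (sym (ℤP.*-identityˡ _)) (gaussPartialSum-p-nonNeg n))) })
  , λ odd → AlternatingSumBound.bound pₒ-increasing n ν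
              (0≤sgn*0 (suc ν) (gaussPartialSum-pₒ-odd n (odd⇒¬isEven n odd)))
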